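{- Let $q$ be a prime power and let $C$ be a cover of $PG(3,q)$ consisting of $q^2$ points and $q$ planes. Then $C$ is a standard cover.
   Context: $PG(3,q)$ is the projective space whose points, lines and planes are the $1$-, $2$- and $3$-dimensional subspaces of $GF(q)^4$; incidence is containment. A cover of $PG(3,q)$ is a set of points and planes such that every line is incident with at least one of these points or planes. A standard cover is obtained as follows: choose a plane $H$, a point $x$ on $H$, and $t$ lines in $H$ through $x$, where $1\le t\le q$; the cover consists of the $q(q+1-t)$ points of $H$ not on any of these $t$ lines, together with the $tq$ planes different from $H$ that contain one of the $t$ lines. -}

module Defs where

open import Level using (0ℓ)
open import Data.Nat using (ℕ; _≤_)
open import Data.Fin using (Fin; zero; suc)
open import Data.List using (List)
open import Data.List.Relation.Unary.Any using (Any)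
open import Data.List.Relation.Unary.AllPairs using (AllPairs)
open import Data.Product using (Σ; ∃; ∃-syntax; Σ-syntax; _×_)
open import Data.Sum using (_⊎_)
open import Relation.Nullary using (¬_)
open import Relation.Binary.PropositionalEquality using (_≡_; _≢_)
open import Function.Bundles using (_⇔_)
open import Algebra.Bundles using (CommutativeRing)

-- Such a field is GF(q), and
-- exists iff q is a prime power.
record IsFiniteField (q : ℕ) (R : CommutativeRing 0ℓ 0ℓ) : Set where
  open CommutativeRing R hiding (zero)
  field
    0≉1       : ¬ (0# ≈ 1#)
    inverse   : ∀ x → ¬ (x ≈ 0#) → ∃[ y ] (x * y ≈ 1#)
    enum      : Fin q → Carrier
    enum-surj : ∀ x → ∃[ i ] (enum i ≈ x)
    enum-inj  : ∀ i j → enum i ≈ enum j → i ≡ j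

module PG (R : CommutativeRing 0ℓ 0ℓ) where
  open CommutativeRing R hiding (zero)

  V4 : Set
  V4 = Fin 4 → Carrier

  NonZeroV : V4 → Set
  NonZeroV v = ¬ (∀ i → v i ≈ 0#)

  -- a point (1-dim subspace) represented by a nonzero spanning vector
  Point : Set
  Point = Σ V4 NonZeroV

  -- a plane (3-dim subspace) represented by a nonzero linear form a,
  -- the plane being the kernel {v | a·v = 0}
  Plane : Set
  Plane = Σ V4 NonZeroV

  dot : V4 → V4 → Carrier
  dot a v = a zero * v zero + a (suc zero) * v (suc zero)
          + a (suc (suc zero)) * v (suc (suc zero))
          + a (suc (suc (suc zero))) * v (suc (suc (suc zero)))

  SameSpan : V4 → V4 → Set
  SameSpan v w = ∃[ c ] (¬ (c ≈ 0#) × (∀ i → w i ≈ c * v i))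

  SamePoint : Point → Point → Set
  SamePoint p p' = SameSpan (Σ.proj₁ p) (Σ.proj₁ p')

  SamePlane : Plane → Plane → Set
  SamePlane h h' = SameSpan (Σ.proj₁ h) (Σ.proj₁ h')

  OnPlane : Point → Plane → Set
  OnPlane p h = dot (Σ.proj₁ h) (Σ.proj₁ p) ≈ 0#

  InSpan : V4 → V4 → V4 → Set
  InSpan u v w = ∃[ α ] ∃[ β ] (∀ i → w i ≈ α * u i + β * v i)

  Independent : V4 → V4 → Set
  Independent u v = ∀ α β → (∀ i → α * u i + β * v i ≈ 0#) → (α ≈ 0#) × (β ≈ 0#)

  record Line : Set where
    constructor line
    field
      u   : V4
      v   : V4
      ind : Independent u v

  OnLine : Point → Line → Set
  OnLine p L = InSpan (Line.u L) (Line.v L) (Σ.proj₁ p)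

  LineInPlane : Line → Plane → Set
  LineInPlane L h = (dot (Σ.proj₁ h) (Line.u L) ≈ 0#) × (dot (Σ.proj₁ h) (Line.v L) ≈ 0#)

  IsCover : List Point → List Plane → Set
  IsCover ps hs = (AllPairs (λ p p' → ¬ SamePoint p p') ps)
                × (AllPairs (λ h h' → ¬ SamePlane h h') hs)
                × (∀ (L : Line) → Any (λ p → OnLine p L) ps ⊎ Any (λ h → LineInPlane L h) hs)

  -- Standard cover: plane H, point x on H, t lines in H through x (1 ≤ t ≤ q),
  -- the i-th line being span(x , y i) with y i a point of H distinct from x,
  -- the lines pairwise distinct; the points of the cover are exactly the points
  -- of H on none of the t lines, and the planes of the cover are exactly the
  -- planes ≠ H containing one of the t lines.
  IsStandardCover : ℕ → List Point → List Plane → Set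
  IsStandardCover q ps hs =
    Σ[ H ∈ Plane ] Σ[ x ∈ Point ] (OnPlane x H × Σ[ t ∈ ℕ ] (1 ≤ t × t ≤ q ×
      Σ[ y ∈ (Fin t → Point) ] (((i : Fin t) → OnPlane (y i) H)
            × ((i : Fin t) → ¬ SamePoint x (y i))
            × ((i j : Fin t) → i ≢ j → ¬ InSpan (Σ.proj₁ x) (Σ.proj₁ (y i)) (Σ.proj₁ (y j)))
            × ((p : Point) → Any (SamePoint p) ps
                 ⇔ (OnPlane p H × ((i : Fin t) → ¬ InSpan (Σ.proj₁ x) (Σ.proj₁ (y i)) (Σ.proj₁ p))))
            × ((K : Plane) → Any (SamePlane K) hs
                 ⇔ (¬ SamePlane H K × Σ[ i ∈ Fin t ] (OnPlane x K × OnPlane (y i) K))))))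

{-# OPTIONS --safe #-}
module Submission where

-- If a point z is neither a point of the cover nor on one of its
-- planes, then each of the q² + q + 1 lines through z needs its own point of the cover, but
-- there are only q². So every point is covered. List the q² points of the cover, then all
-- points of the first plane, then, for each of the other q − 1 planes, its points off the
-- first plane. That is q³ + q² + q + 1 entries, exactly the number of points, so no point is
-- listed twice. Hence no cover point lies on a cover plane, and two cover planes other than
-- the first never meet off the first. This forces every cover plane through the line ℓ where
-- the first two meet. So the cover planes are q of the q + 1 planes through ℓ. If H is the
-- missing one, the cover points are exactly the points of H off ℓ, which is the standard
-- cover with t = 1. The enumerations are explicit in coordinates where the first two planes
-- are x₂ = 0 and x₃ = 0.

open import Defs
open import Level using (Level; 0ℓ)
open import Data.Nat using (ℕ; suc; _^_)
open import Data.List using (List; length; []; _∷_)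
open import Relation.Binary.PropositionalEquality as ≡ using (_≡_)
open import Algebra.Bundles using (CommutativeRing; RawRing)
open import Data.Product using (_,_; proj₁; proj₂)
open import Data.List.Relation.Unary.All using (_∷_)
open import Data.List.Relation.Unary.AllPairs using (_∷_)
import Data.Nat as ℕ
import Data.Nat.Properties as ℕ

module IntegerCoefficientRingSolver {c ℓ : Level} (R : CommutativeRing c ℓ) where

  open import Data.Nat as ℕ using (ℕ; zero; suc; _∸_)
  import Data.Nat.Properties as ℕ
  open import Data.Product using (_,_) renaming (_×_ to _∧_)
  open import Data.Bool using (Bool; true; false; T)
  open import Data.Maybe using (nothing)
  open import Data.Vec using (Vec)
  open import Relation.Binary.PropositionalEquality as ≡ using (_≡_)
  open import Tactic.RingSolver.Core.AlmostCommutativeRing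
  open import Tactic.RingSolver.Core.Polynomial.Parameters
  open import Tactic.RingSolver.Core.Expression public

  open CommutativeRing R hiding (zero)
  open import Algebra.Properties.Semiring.Mult semiring using (_×_; ×-homo-+; ×1-homo-*)
  open import Algebra.Properties.Ring ring
    using (-‿distribˡ-*; -‿distribʳ-*; -‿involutive; -‿+-comm; -0#≈0#)
  open import Algebra.Properties.CommutativeSemigroup +-commutativeSemigroup using (interchange)
  open import Relation.Binary.Reasoning.Setoid setoid

  -- None of the library's solvers proves x - x ≈ 0# in an arbitrary commutative ring:
  -- they need the coefficients to decide their own zeros.  Here the coefficients
  -- are integers, written (p , n) for p − n and kept normalised so that 0 is (0 , 0).
  ℤ₂ : Set
  ℤ₂ = ℕ ∧ ℕ

  normalise : ℤ₂ → ℤ₂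
  normalise (p , n) = (p ∸ n , n ∸ p)

  _+ᶻ_ _*ᶻ_ : ℤ₂ → ℤ₂ → ℤ₂
  (p₁ , n₁) +ᶻ (p₂ , n₂) = normalise (p₁ ℕ.+ p₂ , n₁ ℕ.+ n₂)
  (p₁ , n₁) *ᶻ (p₂ , n₂) = normalise (p₁ ℕ.* p₂ ℕ.+ n₁ ℕ.* n₂ , p₁ ℕ.* n₂ ℕ.+ n₁ ℕ.* p₂)

  -ᶻ_ : ℤ₂ → ℤ₂
  -ᶻ (p , n) = (n , p)

  isZero : ℤ₂ → Bool
  isZero (zero , zero) = true
  isZero _             = false

  integers : RawRing 0ℓ 0ℓ
  integers = record
    { Carrier = ℤ₂ ; _≈_ = _≡_ ; _+_ = _+ᶻ_ ; _*_ = _*ᶻ_ ; -_ = -ᶻ_ ; 0# = (0 , 0) ; 1# = (1 , 0) }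

  almostCommutativeRing : AlmostCommutativeRing c ℓ
  almostCommutativeRing = fromCommutativeRing R (λ _ → nothing)

  embed : ℤ₂ → Carrier
  embed (p , n) = p × 1# - n × 1#

  -- 0 and 1 go to 0# and 1# on the nose, so that the constants of a solved
  -- equation agree with the goal up to definitional equality.
  ⟦_⟧ᶻ : ℤ₂ → Carrier
  ⟦ (zero , zero) ⟧ᶻ     = 0#
  ⟦ (suc zero , zero) ⟧ᶻ = 1#
  ⟦ c ⟧ᶻ                 = embed c

  ∸-balance : ∀ p n → (p ∸ n) ℕ.+ n ≡ (n ∸ p) ℕ.+ p
  ∸-balance zero    zero    = ≡.refl
  ∸-balance zero    (suc n) = ≡.sym (ℕ.+-identityʳ (suc n))
  ∸-balance (suc p) zero    = ℕ.+-identityʳ (suc p)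
  ∸-balance (suc p) (suc n) =
    ≡.trans (ℕ.+-suc (p ∸ n) n) (≡.trans (≡.cong suc (∸-balance p n)) (≡.sym (ℕ.+-suc (n ∸ p) p)))

  -‿+-distrib : ∀ x y → - (x + y) ≈ - x + - y
  -‿+-distrib x y = sym (-‿+-comm x y)

  -‿*-cancel : ∀ x y → - x * - y ≈ x * y
  -‿*-cancel x y = begin
    - x * - y     ≈⟨ -‿distribˡ-* x (- y) ⟨
    - (x * - y)   ≈⟨ -‿cong (-‿distribʳ-* x y) ⟨
    - - (x * y)   ≈⟨ -‿involutive _ ⟩
    x * y         ∎

  differences-equal : ∀ a b c d → a + d ≈ b + c → a - b ≈ c - d
  differences-equal a b c d e = begin
    a - b                  ≈⟨ +-identityʳ _ ⟨
    (a - b) + 0#           ≈⟨ +-congˡ (-‿inverseʳ d) ⟨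
    (a - b) + (d - d)      ≈⟨ interchange a (- b) d (- d) ⟩
    (a + d) + (- b - d)    ≈⟨ +-cong e (+-comm (- b) (- d)) ⟩
    (b + c) + (- d - b)    ≈⟨ interchange b c (- d) (- b) ⟩
    (b - d) + (c - b)      ≈⟨ +-cong (+-comm b (- d)) (+-comm c (- b)) ⟩
    (- d + b) + (- b + c)  ≈⟨ +-assoc (- d) b (- b + c) ⟩
    - d + (b + (- b + c))  ≈⟨ +-congˡ (+-assoc b (- b) c) ⟨
    - d + ((b - b) + c)    ≈⟨ +-congˡ (+-congʳ (-‿inverseʳ b)) ⟩
    - d + (0# + c)         ≈⟨ +-congˡ (+-identityˡ c) ⟩
    - d + c                ≈⟨ +-comm (- d) c ⟩
    c - d                  ∎

  embed-normalise : ∀ c → embed (normalise c) ≈ embed c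
  embed-normalise (p , n) = differences-equal _ _ _ _ (begin
    (p ∸ n) × 1# + n × 1#    ≈⟨ ×-homo-+ 1# (p ∸ n) n ⟨
    ((p ∸ n) ℕ.+ n) × 1#     ≡⟨ ≡.cong (_× 1#) (∸-balance p n) ⟩
    ((n ∸ p) ℕ.+ p) × 1#     ≈⟨ ×-homo-+ 1# (n ∸ p) p ⟩
    (n ∸ p) × 1# + p × 1#    ∎)

  embed-+ : ∀ x y → embed (x +ᶻ y) ≈ embed x + embed y
  embed-+ (p₁ , n₁) (p₂ , n₂) = begin
    embed (normalise (p₁ ℕ.+ p₂ , n₁ ℕ.+ n₂))     ≈⟨ embed-normalise (p₁ ℕ.+ p₂ , n₁ ℕ.+ n₂) ⟩
    (p₁ ℕ.+ p₂) × 1# - (n₁ ℕ.+ n₂) × 1#          ≈⟨ +-cong (×-homo-+ 1# p₁ p₂) (-‿cong (×-homo-+ 1# n₁ n₂)) ⟩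
    (p₁ × 1# + p₂ × 1#) - (n₁ × 1# + n₂ × 1#)    ≈⟨ +-congˡ (-‿+-distrib _ _) ⟩
    (p₁ × 1# + p₂ × 1#) + (- (n₁ × 1#) + - (n₂ × 1#)) ≈⟨ interchange _ _ _ _ ⟩
    embed (p₁ , n₁) + embed (p₂ , n₂)             ∎

  embed-* : ∀ x y → embed (x *ᶻ y) ≈ embed x * embed y
  embed-* (p₁ , n₁) (p₂ , n₂) = begin
    embed (normalise (p₁ ℕ.* p₂ ℕ.+ n₁ ℕ.* n₂ , p₁ ℕ.* n₂ ℕ.+ n₁ ℕ.* p₂))
      ≈⟨ embed-normalise (p₁ ℕ.* p₂ ℕ.+ n₁ ℕ.* n₂ , p₁ ℕ.* n₂ ℕ.+ n₁ ℕ.* p₂) ⟩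
    (p₁ ℕ.* p₂ ℕ.+ n₁ ℕ.* n₂) × 1# - (p₁ ℕ.* n₂ ℕ.+ n₁ ℕ.* p₂) × 1#
      ≈⟨ +-cong (sum-of-products p₁ p₂ n₁ n₂) (-‿cong (sum-of-products p₁ n₂ n₁ p₂)) ⟩
    (a₁ * a₂ + b₁ * b₂) - (a₁ * b₂ + b₁ * a₂)              ≈⟨ +-congˡ (-‿+-distrib _ _) ⟩
    (a₁ * a₂ + b₁ * b₂) + (- (a₁ * b₂) + - (b₁ * a₂))      ≈⟨ interchange _ _ _ _ ⟩
    (a₁ * a₂ + - (a₁ * b₂)) + (b₁ * b₂ + - (b₁ * a₂))
      ≈⟨ +-cong (+-congˡ (-‿distribʳ-* a₁ b₂)) (+-cong (sym (-‿*-cancel b₁ b₂)) (-‿distribˡ-* b₁ a₂)) ⟩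
    (a₁ * a₂ + a₁ * - b₂) + (- b₁ * - b₂ + - b₁ * a₂)
      ≈⟨ +-cong (distribˡ a₁ a₂ (- b₂)) (trans (*-congˡ (+-comm _ _)) (distribˡ (- b₁) (- b₂) a₂)) ⟨
    a₁ * (a₂ - b₂) + - b₁ * (a₂ - b₂)                      ≈⟨ distribʳ (a₂ - b₂) a₁ (- b₁) ⟨
    (a₁ - b₁) * (a₂ - b₂)                                  ∎
    where
    a₁ a₂ b₁ b₂ : Carrier
    a₁ = p₁ × 1#
    a₂ = p₂ × 1#
    b₁ = n₁ × 1#
    b₂ = n₂ × 1#
    sum-of-products : ∀ i j k l → (i ℕ.* j ℕ.+ k ℕ.* l) × 1# ≈ i × 1# * (j × 1#) + k × 1# * (l × 1#)
    sum-of-products i j k l = trans (×-homo-+ 1# (i ℕ.* j) (k ℕ.* l)) (+-cong (×1-homo-* i j) (×1-homo-* k l))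

  embed-- : ∀ x → embed (-ᶻ x) ≈ - embed x
  embed-- (p , n) = begin
    n × 1# - p × 1#               ≈⟨ +-comm _ _ ⟩
    - (p × 1#) + n × 1#           ≈⟨ +-congˡ (-‿involutive _) ⟨
    - (p × 1#) + - - (n × 1#)     ≈⟨ -‿+-distrib _ _ ⟨
    - (p × 1# - n × 1#)           ∎

  ⟦⟧ᶻ≈embed : ∀ x → ⟦ x ⟧ᶻ ≈ embed x
  ⟦⟧ᶻ≈embed (zero , zero)         = sym (-‿inverseʳ 0#)
  ⟦⟧ᶻ≈embed (suc zero , zero)     = sym (trans (+-cong (+-identityʳ 1#) -0#≈0#) (+-identityʳ 1#))
  ⟦⟧ᶻ≈embed (zero , suc n)        = refl
  ⟦⟧ᶻ≈embed (suc zero , suc n)    = refl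
  ⟦⟧ᶻ≈embed (suc (suc p) , n)     = refl

  morphism : integers -Raw-AlmostCommutative⟶ almostCommutativeRing
  morphism = record
    { ⟦_⟧    = ⟦_⟧ᶻ
    ; +-homo = λ x y → trans (⟦⟧ᶻ≈embed (x +ᶻ y)) (trans (embed-+ x y) (sym (+-cong (⟦⟧ᶻ≈embed x) (⟦⟧ᶻ≈embed y))))
    ; *-homo = λ x y → trans (⟦⟧ᶻ≈embed (x *ᶻ y)) (trans (embed-* x y) (sym (*-cong (⟦⟧ᶻ≈embed x) (⟦⟧ᶻ≈embed y))))
    ; -‿homo = λ x → trans (⟦⟧ᶻ≈embed (-ᶻ x)) (trans (embed-- x) (sym (-‿cong (⟦⟧ᶻ≈embed x))))
    ; 0-homo = refl
    ; 1-homo = refl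
    }

  isZero-sound : ∀ x → T (isZero x) → 0# ≈ ⟦ x ⟧ᶻ
  isZero-sound (zero , zero) _ = refl

  homomorphism : Homomorphism 0ℓ 0ℓ c ℓ
  homomorphism = record
    { from          = record { rawRing = integers ; isZero = isZero }
    ; to            = almostCommutativeRing
    ; morphism      = morphism
    ; Zero-C⟶Zero-R = isZero-sound
    }

  open Eval (AlmostCommutativeRing.rawRing almostCommutativeRing) ⟦_⟧ᶻ public
  open import Algebra.Properties.Semiring.Exp.TCOptimised (AlmostCommutativeRing.semiring almostCommutativeRing) using (^-congˡ)
  open import Tactic.RingSolver.Core.Polynomial.Base (Homomorphism.from homomorphism)

  norm : ∀ {n} → Expr ℤ₂ n → Poly n
  norm (Κ x)   = κ x
  norm (Ι x)   = ι x
  norm (x ⊕ y) = norm x ⊞ norm y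
  norm (x ⊗ y) = norm x ⊠ norm y
  norm (⊝ x)   = ⊟ norm x
  norm (x ⊛ i) = norm x ⊡ i

  ⟦_⇓⟧ : ∀ {n} → Expr ℤ₂ n → Vec Carrier n → Carrier
  ⟦ expr ⇓⟧ = ⟦ norm expr ⟧ₚ
    where open import Tactic.RingSolver.Core.Polynomial.Semantics homomorphism renaming (⟦_⟧ to ⟦_⟧ₚ)

  correct : ∀ {n} (expr : Expr ℤ₂ n) ρ → ⟦ expr ⇓⟧ ρ ≈ ⟦ expr ⟧ ρ
  correct {n} = go
    where
    open import Tactic.RingSolver.Core.Polynomial.Homomorphism homomorphism
    go : ∀ (expr : Expr ℤ₂ n) ρ → ⟦ expr ⇓⟧ ρ ≈ ⟦ expr ⟧ ρ
    go (Κ x)   ρ = κ-hom x ρ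
    go (Ι x)   ρ = ι-hom x ρ
    go (x ⊕ y) ρ = trans (⊞-hom (norm x) (norm y) ρ) (+-cong (go x ρ) (go y ρ))
    go (x ⊗ y) ρ = trans (⊠-hom (norm x) (norm y) ρ) (*-cong (go x ρ) (go y ρ))
    go (⊝ x)   ρ = trans (⊟-hom (norm x) ρ) (-‿cong (go x ρ))
    go (x ⊛ i) ρ = trans (⊡-hom (norm x) i ρ) (^-congˡ i (go x ρ))

  open import Relation.Binary.Reflection setoid Ι ⟦_⟧ ⟦_⇓⟧ correct public

  0ᵉ 1ᵉ : ∀ {n} → Expr ℤ₂ n
  0ᵉ = Κ (0 , 0)
  1ᵉ = Κ (1 , 0)


module Combinatorics where

  open import Data.Nat as ℕ using (ℕ; zero; suc; _≤_; _<_; s≤s)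
  import Data.Nat.Properties as ℕ
  open import Data.Fin as Fin using (Fin; zero; suc; _↑ˡ_; _↑ʳ_; combine; remQuot; punchOut)
  import Data.Fin.Properties as Fin
  open import Data.Product using (∃; _×_; _,_; proj₁; proj₂)
  open import Data.Sum using (inj₁; inj₂)
  open import Data.Empty using (⊥-elim)
  open import Data.List using (List; lookup)
  open import Data.List.Relation.Unary.All as All using (All)
  open import Data.List.Relation.Unary.AllPairs using (AllPairs; _∷_)
  open import Data.List.Membership.Propositional.Properties using (∈-lookup)
  open import Data.Vec.Functional using (Vector; _++_; concat)
  open import Data.Vec.Functional.Properties using (lookup-++ˡ; lookup-++ʳ)
  import Data.Vec.Functional.Relation.Unary.Any as Vecᶠ
  open import Function.Definitions using (Injective)
  open import Relation.Nullary using (¬_; yes; no)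
  open import Relation.Binary.Core using (Rel)
  open import Relation.Binary.Definitions using (Symmetric; Transitive)
  open import Relation.Binary.PropositionalEquality as ≡ using (_≡_; _≢_; refl; cong; subst)

  private
    variable
      a ℓ : Level
      A : Set a
      m n : ℕ

  lookup-concat : (xss : Vector (Vector A n) m) (i : Fin m) (j : Fin n) → concat xss (combine i j) ≡ xss i j
  lookup-concat xss i j = cong (λ (i , j) → xss i j) (Fin.remQuot-combine i j)

  injective-missing⇒< : {h : Fin n → Fin m} → Injective _≡_ _≡_ h → (s : Fin m) → (∀ i → h i ≢ s) → n < m
  injective-missing⇒< {m = suc m} {h = h} h-inj s h≢s = s≤s (Fin.injective⇒≤ h′-inj)
    where
    s≢h : ∀ i → s ≢ h i
    s≢h i = λ e → h≢s i (≡.sym e)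
    h′ : Fin _ → Fin m
    h′ i = punchOut (s≢h i)
    h′-inj : Injective _≡_ _≡_ h′
    h′-inj {i} {j} e = h-inj (Fin.punchOut-injective (s≢h i) (s≢h j) e)

  injective-missing-two⇒ : {h : Fin n → Fin m} → Injective _≡_ _≡_ h → (s t : Fin m) → s ≢ t →
    (∀ i → h i ≢ s) → (∀ i → h i ≢ t) → 2 ℕ.+ n ≤ m
  injective-missing-two⇒ {m = suc m} {h = h} h-inj s t s≢t h≢s h≢t =
    s≤s (injective-missing⇒< h′-inj (punchOut s≢t) h′≢t′)
    where
    s≢h : ∀ i → s ≢ h i
    s≢h i = λ e → h≢s i (≡.sym e)
    h′ : Fin _ → Fin m
    h′ i = punchOut (s≢h i)
    h′-inj : Injective _≡_ _≡_ h′
    h′-inj {i} {j} e = h-inj (Fin.punchOut-injective (s≢h i) (s≢h j) e)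
    h′≢t′ : ∀ i → h′ i ≢ punchOut s≢t
    h′≢t′ i e = h≢t i (Fin.punchOut-injective (s≢h i) s≢t e)

  2+n≰n+1 : ∀ n → ¬ (2 ℕ.+ n ≤ n ℕ.+ 1)
  2+n≰n+1 n le = ℕ.n≮n (suc n) (subst (2 ℕ.+ n ≤_) (ℕ.+-comm n 1) le)

  ↑ˡ≢↑ʳ : ∀ (i : Fin m) (j : Fin n) → i ↑ˡ n ≢ m ↑ʳ j
  ↑ˡ≢↑ʳ {m} {n} i j eq with ≡.trans (≡.sym (Fin.splitAt-↑ˡ m i n)) (≡.trans (cong (Fin.splitAt m) eq) (Fin.splitAt-↑ʳ m n j))
  ... | ()

  AllPairs-lookup-injective : {R : Rel A ℓ} → Symmetric R → {xs : List A} →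
    AllPairs (λ x y → ¬ R x y) xs → ∀ i j → R (lookup xs i) (lookup xs j) → i ≡ j
  AllPairs-lookup-injective sym (_ ∷ _)       zero    zero    _ = refl
  AllPairs-lookup-injective sym (¬Rx ∷ _)     zero    (suc j) r = ⊥-elim (All.lookup ¬Rx (∈-lookup j) r)
  AllPairs-lookup-injective sym (¬Rx ∷ _)     (suc i) zero    r = ⊥-elim (All.lookup ¬Rx (∈-lookup i) (sym r))
  AllPairs-lookup-injective sym (_ ∷ ¬Rxs)    (suc i) (suc j) r = cong suc (AllPairs-lookup-injective sym ¬Rxs i j r)

  -- Vectors Fin n → A as finite lists of elements of A up to a partial equivalence ∼.
  module Listing {A : Set a} (_∼_ : Rel A ℓ) (∼-sym : Symmetric _∼_) (∼-trans : Transitive _∼_) where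

    Lists : Vector A m → A → Set _
    Lists f x = Vecᶠ.Any (_∼ x) f

    Irredundant : Vector A n → Set _
    Irredundant f = ∀ i j → f i ∼ f j → i ≡ j

    Exhausts : Vector A m → Vector A n → Set _
    Exhausts g f = ∀ i → Lists g (f i)

    lists-++ˡ : (f : Vector A m) (g : Vector A n) {x : A} → Lists f x → Lists (f ++ g) x
    lists-++ˡ {n = n} f g (i , fi∼x) = i ↑ˡ n , subst (_∼ _) (≡.sym (lookup-++ˡ f g i)) fi∼x

    lists-++ʳ : (f : Vector A m) (g : Vector A n) {x : A} → Lists g x → Lists (f ++ g) x
    lists-++ʳ {m = m} f g (j , gj∼x) = m ↑ʳ j , subst (_∼ _) (≡.sym (lookup-++ʳ f g j)) gj∼x

    lists-concat : (F : Vector (Vector A n) m) {x : A} → (∃ λ i → Lists (F i) x) → Lists (concat F) x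
    lists-concat F (i , j , Fij∼x) = combine i j , subst (_∼ _) (≡.sym (lookup-concat F i j)) Fij∼x

    irredundant-++ : (f : Vector A m) (g : Vector A n) → Irredundant f → Irredundant g →
      (∀ i j → ¬ f i ∼ g j) → Irredundant (f ++ g)
    irredundant-++ {m = m} {n = n} f g f-irr g-irr f≁g k l fk∼gl
      with Fin.splitAt m k in eqk | Fin.splitAt m l in eql
    ... | inj₁ i | inj₁ j = ≡.trans (≡.sym (Fin.splitAt⁻¹-↑ˡ eqk)) (≡.trans (cong (_↑ˡ n) (f-irr i j fk∼gl)) (Fin.splitAt⁻¹-↑ˡ eql))
    ... | inj₁ i | inj₂ j = ⊥-elim (f≁g i j fk∼gl)
    ... | inj₂ i | inj₁ j = ⊥-elim (f≁g j i (∼-sym fk∼gl))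
    ... | inj₂ i | inj₂ j = ≡.trans (≡.sym (Fin.splitAt⁻¹-↑ʳ eqk)) (≡.trans (cong (m ↑ʳ_) (g-irr i j fk∼gl)) (Fin.splitAt⁻¹-↑ʳ eql))

    irredundant-concat : (F : Vector (Vector A n) m) →
      (∀ i j i′ j′ → F i j ∼ F i′ j′ → i ≡ i′ × j ≡ j′) → Irredundant (concat F)
    irredundant-concat {n = n} {m = m} F F-irr k l Fk∼Fl =
      ≡.trans (≡.sym (Fin.combine-remQuot {m} n k)) (≡.trans (cong (λ (i , j) → combine i j) rq≡) (Fin.combine-remQuot {m} n l))
      where
      rq≡ : remQuot {m} n k ≡ remQuot {m} n l
      rq≡ = let (i≡i′ , j≡j′) = F-irr _ _ _ _ Fk∼Fl in ≡.cong₂ _,_ i≡i′ j≡j′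

    choice : {f : Vector A n} {g : Vector A m} → Exhausts g f → Fin n → Fin m
    choice g⊇f i = proj₁ (g⊇f i)

    choice-injective : {f : Vector A n} {g : Vector A m} → Irredundant f → (g⊇f : Exhausts g f) →
      Injective _≡_ _≡_ (choice g⊇f)
    choice-injective {f = f} {g} f-irr g⊇f {i} {j} e =
      f-irr i j (∼-trans (∼-sym (proj₂ (g⊇f i))) (subst (λ k → g k ∼ f j) (≡.sym e) (proj₂ (g⊇f j))))

    exhausts⇒≤ : {f : Vector A n} {g : Vector A m} → Irredundant f → Exhausts g f → n ≤ m
    exhausts⇒≤ f-irr g⊇f = Fin.injective⇒≤ (choice-injective f-irr g⊇f)

    choice-misses : {f : Vector A n} {g : Vector A m} → Irredundant f → (g⊇f : Exhausts g f) →
      ∀ i {k} → choice g⊇f i ≢ k → g k ∼ f i → ∀ j → choice g⊇f j ≢ k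
    choice-misses {f = f} {g} f-irr g⊇f i ci≢k gk∼fi j cj≡k
      with f-irr i j (∼-trans (∼-sym gk∼fi) (subst (λ k → g k ∼ f j) cj≡k (proj₂ (g⊇f j))))
    ... | refl = ci≢k cj≡k

    -- If g is no longer than f, choice is a bijection, so no element of f is listed twice by g.
    exhausts-exactly : {f : Vector A n} {g : Vector A m} → Irredundant f → Exhausts g f → m ≤ n →
      ∀ {k l} i → g k ∼ f i → g l ∼ f i → k ≡ l
    exhausts-exactly {f = f} {g} f-irr g⊇f m≤n {k} {l} i gk∼fi gl∼fi with k Fin.≟ l
    ... | yes k≡l = k≡l
    ... | no k≢l = ⊥-elim (ℕ.<⇒≱ (injective-missing⇒< (choice-injective f-irr g⊇f) (proj₁ unlisted) (proj₂ unlisted)) m≤n)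
      where
      unlisted : ∃ λ x → ∀ j → choice g⊇f j ≢ x
      unlisted with choice g⊇f i Fin.≟ k
      ... | yes ci≡k = l , choice-misses f-irr g⊇f i (λ ci≡l → k≢l (≡.trans (≡.sym ci≡k) ci≡l)) gl∼fi
      ... | no ci≢k  = k , choice-misses f-irr g⊇f i ci≢k gk∼fi

module FiniteProjectiveSpace (q : ℕ) (R : CommutativeRing 0ℓ 0ℓ) (FF : IsFiniteField q R) where

  open import Data.Nat as ℕ using (suc)
  open import Data.Fin as Fin using (Fin; zero; suc)
  import Data.Fin.Properties as Fin
  open import Data.Product using (∃; _×_; _,_; proj₁; proj₂)
  open import Data.Sum using (_⊎_; inj₁; inj₂)
  open import Data.Empty using (⊥-elim)
  open import Relation.Nullary using (¬_; Dec; yes; no; contradiction)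
  open import Relation.Nullary.Decidable using (_×-dec_; ¬?)
  open import Relation.Binary.PropositionalEquality as ≡ using (_≢_; refl; subst; cong)
  open import Data.Vec.Functional using (Vector; _++_; concat)
  open import Data.Vec.Functional.Relation.Unary.All using (All)
  import Data.Vec.Functional.Relation.Unary.All.Properties as All
  open CommutativeRing R renaming (Carrier to F; refl to ≈-refl; sym to ≈-sym; trans to ≈-trans) hiding (zero)
  open PG R
  open IsFiniteField FF
  open import Algebra.Properties.Ring ring using (-‿involutive; -0#≈0#)
  open import Relation.Binary.Reasoning.Setoid setoid
  open IntegerCoefficientRingSolver R using (solve; _⊜_; _⊕_; _⊗_; ⊝_; 0ᵉ; 1ᵉ)

  infix 4 _≟F_
  _≟F_ : (x y : F) → Dec (x ≈ y)
  x ≟F y with enum-surj x | enum-surj y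
  ... | (i , ei≈x) | (j , ej≈y) with i Fin.≟ j
  ... | yes refl = yes (≈-trans (≈-sym ei≈x) ej≈y)
  ... | no i≢j   = no (λ x≈y → i≢j (enum-inj i j (≈-trans ei≈x (≈-trans x≈y (≈-sym ej≈y)))))

  _≉0 : F → Set
  x ≉0 = ¬ (x ≈ 0#)

  -- 0 ⁻¹ is a junk value 0#.
  infix 10 _⁻¹
  _⁻¹ : F → F
  x ⁻¹ with x ≟F 0#
  ... | yes _ = 0#
  ... | no x≉0 = proj₁ (inverse x x≉0)

  ⁻¹-inverseʳ : ∀ {x} → x ≉0 → x * x ⁻¹ ≈ 1#
  ⁻¹-inverseʳ {x} x≉0 with x ≟F 0#
  ... | yes x≈0 = contradiction x≈0 x≉0
  ... | no x≉0′ = proj₂ (inverse x x≉0′)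

  ⁻¹-inverseˡ : ∀ {x} → x ≉0 → x ⁻¹ * x ≈ 1#
  ⁻¹-inverseˡ x≉0 = ≈-trans (*-comm _ _) (⁻¹-inverseʳ x≉0)

  1≉0 : 1# ≉0
  1≉0 1≈0 = 0≉1 (≈-sym 1≈0)

  cancel-nonzeroˡ : ∀ {x y} → x * y ≈ 0# → x ≉0 → y ≈ 0#
  cancel-nonzeroˡ {x} {y} xy≈0 x≉0 = begin
    y                ≈⟨ *-identityʳ y ⟨
    y * 1#           ≈⟨ *-congˡ (⁻¹-inverseʳ x≉0) ⟨
    y * (x * x ⁻¹)   ≈⟨ solve 3 (λ x y i → y ⊗ (x ⊗ i) ⊜ (x ⊗ y) ⊗ i) ≈-refl x y (x ⁻¹) ⟩
    (x * y) * x ⁻¹   ≈⟨ *-congʳ xy≈0 ⟩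
    0# * x ⁻¹        ≈⟨ zeroˡ _ ⟩
    0#               ∎

  *-nonzero : ∀ {x y} → x ≉0 → y ≉0 → (x * y) ≉0
  *-nonzero x≉0 y≉0 xy≈0 = y≉0 (cancel-nonzeroˡ xy≈0 x≉0)

  ⁻¹-nonzero : ∀ {x} → x ≉0 → (x ⁻¹) ≉0
  ⁻¹-nonzero {x} x≉0 x⁻¹≈0 = 1≉0 (≈-trans (≈-sym (⁻¹-inverseʳ x≉0)) (≈-trans (*-congˡ x⁻¹≈0) (zeroʳ x)))

  q≡2+ : ∃ λ r → q ≡ suc (suc r)
  q≡2+ = at-least-two q enum enum-surj
    where
    at-least-two : ∀ n (f : Fin n → F) → (∀ x → ∃ λ i → f i ≈ x) → ∃ λ r → n ≡ suc (suc r)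
    at-least-two 0             f f-surj with () ← proj₁ (f-surj 0#)
    at-least-two 1             f f-surj with f-surj 0# | f-surj 1#
    ... | zero , f0≈0 | zero , f0≈1 = ⊥-elim (0≉1 (≈-trans (≈-sym f0≈0) f0≈1))
    at-least-two (suc (suc r)) _ _      = r , refl

  -- Vectors, forms and spans

  pattern i₀ = zero
  pattern i₁ = suc zero
  pattern i₂ = suc (suc zero)
  pattern i₃ = suc (suc (suc zero))

  V : Set
  V = V4

  vec : F → F → F → F → V
  vec a b c d i₀ = a
  vec a b c d i₁ = b
  vec a b c d i₂ = c
  vec a b c d i₃ = d

  infix 4 _≋_
  _≋_ : V → V → Set
  u ≋ v = ∀ i → u i ≈ v i

  nonzero-coordinate : ∀ {v} → NonZeroV v → ∃ λ k → v k ≉0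
  nonzero-coordinate {v} v≉0 = Fin.¬∀⟶∃¬ 4 (λ i → v i ≈ 0#) (λ i → v i ≟F 0#) v≉0

  nonzero-at : ∀ {v} k → v k ≉0 → NonZeroV v
  nonzero-at k vk≉0 v≈0 = vk≉0 (v≈0 k)

  lin : F → V → F → V → V
  lin α u β w i = α * u i + β * w i

  scale : F → V → V
  scale c v i = c * v i

  dot-lin : ∀ a α u β w → dot a (lin α u β w) ≈ α * dot a u + β * dot a w
  dot-lin a α u β w = solve 14 (λ a₀ a₁ a₂ a₃ α u₀ u₁ u₂ u₃ β w₀ w₁ w₂ w₃ →
     a₀ ⊗ (α ⊗ u₀ ⊕ β ⊗ w₀) ⊕ a₁ ⊗ (α ⊗ u₁ ⊕ β ⊗ w₁) ⊕ a₂ ⊗ (α ⊗ u₂ ⊕ β ⊗ w₂) ⊕ a₃ ⊗ (α ⊗ u₃ ⊕ β ⊗ w₃)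
     ⊜ α ⊗ (a₀ ⊗ u₀ ⊕ a₁ ⊗ u₁ ⊕ a₂ ⊗ u₂ ⊕ a₃ ⊗ u₃) ⊕ β ⊗ (a₀ ⊗ w₀ ⊕ a₁ ⊗ w₁ ⊕ a₂ ⊗ w₂ ⊕ a₃ ⊗ w₃)) ≈-refl
     (a i₀) (a i₁) (a i₂) (a i₃) α (u i₀) (u i₁) (u i₂) (u i₃) β (w i₀) (w i₁) (w i₂) (w i₃)

  dot-scaleʳ : ∀ a c v → dot a (scale c v) ≈ c * dot a v
  dot-scaleʳ a c v = solve 9 (λ a₀ a₁ a₂ a₃ c v₀ v₁ v₂ v₃ →
     a₀ ⊗ (c ⊗ v₀) ⊕ a₁ ⊗ (c ⊗ v₁) ⊕ a₂ ⊗ (c ⊗ v₂) ⊕ a₃ ⊗ (c ⊗ v₃)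
     ⊜ c ⊗ (a₀ ⊗ v₀ ⊕ a₁ ⊗ v₁ ⊕ a₂ ⊗ v₂ ⊕ a₃ ⊗ v₃)) ≈-refl
     (a i₀) (a i₁) (a i₂) (a i₃) c (v i₀) (v i₁) (v i₂) (v i₃)

  dot-comm : ∀ a v → dot a v ≈ dot v a
  dot-comm a v = solve 8 (λ a₀ a₁ a₂ a₃ v₀ v₁ v₂ v₃ →
     a₀ ⊗ v₀ ⊕ a₁ ⊗ v₁ ⊕ a₂ ⊗ v₂ ⊕ a₃ ⊗ v₃ ⊜ v₀ ⊗ a₀ ⊕ v₁ ⊗ a₁ ⊕ v₂ ⊗ a₂ ⊕ v₃ ⊗ a₃) ≈-refl
     (a i₀) (a i₁) (a i₂) (a i₃) (v i₀) (v i₁) (v i₂) (v i₃)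

  dot-cong : ∀ {a a′ v v′} → a ≋ a′ → v ≋ v′ → dot a v ≈ dot a′ v′
  dot-cong a≋ v≋ = +-cong (+-cong (+-cong (*-cong (a≋ i₀) (v≋ i₀)) (*-cong (a≋ i₁) (v≋ i₁))) (*-cong (a≋ i₂) (v≋ i₂))) (*-cong (a≋ i₃) (v≋ i₃))

  dot-congˡ : ∀ {a a′} v → a ≋ a′ → dot a v ≈ dot a′ v
  dot-congˡ {a} {a′} v a≋ = dot-cong {a} {a′} {v} {v} a≋ (λ _ → ≈-refl)

  dot-congʳ : ∀ a {v v′} → v ≋ v′ → dot a v ≈ dot a v′
  dot-congʳ a {v} {v′} v≋ = dot-cong {a} {a} {v} {v′} (λ _ → ≈-refl) v≋

  dot-scaleˡ : ∀ c a v → dot (scale c a) v ≈ c * dot a v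
  dot-scaleˡ c a v = ≈-trans (dot-comm (scale c a) v) (≈-trans (dot-scaleʳ v c a) (*-congˡ (dot-comm v a)))

  SameSpan-refl : ∀ v → SameSpan v v
  SameSpan-refl v = 1# , 1≉0 , λ i → ≈-sym (*-identityˡ (v i))

  SameSpan-sym : ∀ {v w} → SameSpan v w → SameSpan w v
  SameSpan-sym {v} {w} (c , c≉0 , w≈cv) = c ⁻¹ , ⁻¹-nonzero c≉0 , λ i → begin
    v i                ≈⟨ *-identityˡ (v i) ⟨
    1# * v i           ≈⟨ *-congʳ (⁻¹-inverseˡ c≉0) ⟨
    (c ⁻¹ * c) * v i   ≈⟨ *-assoc _ _ _ ⟩
    c ⁻¹ * (c * v i)   ≈⟨ *-congˡ (w≈cv i) ⟨
    c ⁻¹ * w i         ∎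

  SameSpan-trans : ∀ {u v w} → SameSpan u v → SameSpan v w → SameSpan u w
  SameSpan-trans {u} {v} {w} (c , c≉0 , v≈cu) (d , d≉0 , w≈dv) = d * c , *-nonzero d≉0 c≉0 , λ i → begin
    w i             ≈⟨ w≈dv i ⟩
    d * v i         ≈⟨ *-congˡ (v≈cu i) ⟩
    d * (c * u i)   ≈⟨ *-assoc _ _ _ ⟨
    (d * c) * u i   ∎

  SameSpan-congˡ : ∀ {u u′ w} → u ≋ u′ → SameSpan u w → SameSpan u′ w
  SameSpan-congˡ u≋ (c , c≉0 , w≈cu) = c , c≉0 , λ i → ≈-trans (w≈cu i) (*-congˡ (u≋ i))

  SameSpan-≡ˡ : ∀ {u u′ w} → u ≡ u′ → SameSpan u′ w → SameSpan u w
  SameSpan-≡ˡ refl s = s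

  SameSpan? : ∀ v w → Dec (SameSpan v w)
  SameSpan? v w with Fin.any? (λ i → ¬? (enum i ≟F 0#) ×-dec Fin.all? (λ k → w k ≟F enum i * v k))
  ... | yes (i , ei≉0 , w≈eiv) = yes (enum i , ei≉0 , w≈eiv)
  ... | no ∄i = no λ { (c , c≉0 , w≈cv) → let (i , ei≈c) = enum-surj c in
          ∄i (i , (λ ei≈0 → c≉0 (≈-trans (≈-sym ei≈c) ei≈0)) , (λ k → ≈-trans (w≈cv k) (*-congʳ (≈-sym ei≈c)))) }

  dot-≈0-respʳ : ∀ a {v w} → SameSpan v w → dot a v ≈ 0# → dot a w ≈ 0#
  dot-≈0-respʳ a {v} {w} (c , _ , w≈cv) av≈0 = begin
    dot a w            ≈⟨ dot-congʳ a w≈cv ⟩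
    dot a (scale c v)  ≈⟨ dot-scaleʳ a c v ⟩
    c * dot a v        ≈⟨ *-congˡ av≈0 ⟩
    c * 0#             ≈⟨ zeroʳ c ⟩
    0#                 ∎

  dot-≈0-respˡ : ∀ {a b} v → SameSpan a b → dot a v ≈ 0# → dot b v ≈ 0#
  dot-≈0-respˡ {a} {b} v a~b av≈0 = ≈-trans (dot-comm b v) (dot-≈0-respʳ v a~b (≈-trans (dot-comm v a) av≈0))

  dot-≉0-respʳ : ∀ a {v w} → SameSpan v w → dot a v ≉0 → dot a w ≉0
  dot-≉0-respʳ a v~w av≉0 aw≈0 = av≉0 (dot-≈0-respʳ a (SameSpan-sym v~w) aw≈0)

  coordinate-≈0-resp : ∀ {v w} k → SameSpan v w → v k ≈ 0# → w k ≈ 0#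
  coordinate-≈0-resp {v} {w} k (c , _ , w≈cv) vk≈0 = ≈-trans (w≈cv k) (≈-trans (*-congˡ vk≈0) (zeroʳ c))

  SameSpan-multiple : ∀ {v w} c → NonZeroV w → (∀ i → w i ≈ c * v i) → SameSpan v w
  SameSpan-multiple {v} c w≉0 w≈cv = c , (λ c≈0 → w≉0 λ i → ≈-trans (w≈cv i) (≈-trans (*-congʳ c≈0) (zeroˡ (v i)))) , w≈cv

  sum-≈0-dropʳ : ∀ {x y} → y ≈ 0# → x + y ≈ 0# → x ≈ 0#
  sum-≈0-dropʳ y≈0 x+y≈0 = ≈-trans (≈-sym (≈-trans (+-congˡ y≈0) (+-identityʳ _))) x+y≈0

  sum-≈0-dropˡ : ∀ {x y} → x ≈ 0# → x + y ≈ 0# → y ≈ 0#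
  sum-≈0-dropˡ x≈0 x+y≈0 = ≈-trans (≈-sym (≈-trans (+-congʳ x≈0) (+-identityˡ _))) x+y≈0

  independent : ∀ {z w} → NonZeroV z → NonZeroV w → ¬ SameSpan z w → Independent z w
  independent {z} {w} z≉0 w≉0 z≁w α β αz+βw≈0 with β ≟F 0# | α ≟F 0#
  ... | yes β≈0 | _ =
    let (k , zₖ≉0) = nonzero-coordinate z≉0 in
    cancel-nonzeroˡ (≈-trans (*-comm (z k) α) (sum-≈0-dropʳ (≈-trans (*-congʳ β≈0) (zeroˡ _)) (αz+βw≈0 k))) zₖ≉0 , β≈0
  ... | no β≉0 | yes α≈0 =
    ⊥-elim (w≉0 λ i → cancel-nonzeroˡ (sum-≈0-dropˡ (≈-trans (*-congʳ α≈0) (zeroˡ _)) (αz+βw≈0 i)) β≉0)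
  ... | no β≉0 | no _ = ⊥-elim (z≁w (SameSpan-multiple c w≉0 w≈cz))
    where
    c : F
    c = (- α) * β ⁻¹
    w≈cz : ∀ i → w i ≈ c * z i
    w≈cz i = begin
      w i                                  ≈⟨ *-identityˡ (w i) ⟨
      1# * w i                             ≈⟨ *-congʳ (⁻¹-inverseˡ β≉0) ⟨
      (β ⁻¹ * β) * w i                     ≈⟨ solve 5 (λ b⁻¹ b wᵢ a zᵢ → (b⁻¹ ⊗ b) ⊗ wᵢ ⊜ b⁻¹ ⊗ (a ⊗ zᵢ ⊕ b ⊗ wᵢ) ⊕ (⊝ a ⊗ b⁻¹) ⊗ zᵢ)
                                                ≈-refl (β ⁻¹) β (w i) α (z i) ⟩
      β ⁻¹ * (α * z i + β * w i) + c * z i ≈⟨ +-congʳ (≈-trans (*-congˡ (αz+βw≈0 i)) (zeroʳ (β ⁻¹))) ⟩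
      0# + c * z i                         ≈⟨ +-identityˡ (c * z i) ⟩
      c * z i                              ∎

  open Combinatorics
  open Listing SameSpan SameSpan-sym SameSpan-trans public

  -- Explicit enumerations of points and planes

  Lists? : ∀ {n} (f : Vector V n) w → Dec (Lists f w)
  Lists? f w = Fin.any? λ i → SameSpan? (f i) w

  normalised-SameSpan : ∀ {u w} k → w k ≉0 → (∀ i → u i ≈ w i * w k ⁻¹) → SameSpan u w
  normalised-SameSpan {u} {w} k wk≉0 u≈w/wk = w k , wk≉0 , λ i → begin
    w i                    ≈⟨ *-identityʳ (w i) ⟨
    w i * 1#               ≈⟨ *-congˡ (⁻¹-inverseʳ wk≉0) ⟨
    w i * (w k * w k ⁻¹)   ≈⟨ solve 3 (λ a b c → a ⊗ (b ⊗ c) ⊜ b ⊗ (a ⊗ c)) ≈-refl (w i) (w k) (w k ⁻¹) ⟩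
    w k * (w i * w k ⁻¹)   ≈⟨ *-congˡ (u≈w/wk i) ⟨
    w k * u i              ∎

  normalised-pivot : ∀ (w : V) k → w k ≉0 → 1# ≈ w k * w k ⁻¹
  normalised-pivot w k wk≉0 = ≈-sym (⁻¹-inverseʳ wk≉0)

  normalised-zero : ∀ (w : V) k i → w i ≈ 0# → 0# ≈ w i * w k ⁻¹
  normalised-zero w k i wi≈0 = ≈-sym (≈-trans (*-congʳ wi≈0) (zeroˡ _))

  normalised-enum : ∀ (w : V) k i → ∃ λ a → enum a ≈ w i * w k ⁻¹
  normalised-enum w k i = enum-surj (w i * w k ⁻¹)

  enum-injective : ∀ {a b} → enum b ≈ enum a → a ≡ b
  enum-injective {a} {b} eb≈ea = enum-inj a b (≈-sym eb≈ea)

  SameSpan-one-one : ∀ {u w} k → SameSpan u w → u k ≈ 1# → w k ≈ 1# → w ≋ u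
  SameSpan-one-one {u} {w} k (c , _ , w≈cu) uk≈1 wk≈1 i = ≈-trans (w≈cu i) (≈-trans (*-congʳ c≈1) (*-identityˡ (u i)))
    where
    c≈1 : c ≈ 1#
    c≈1 = ≈-trans (≈-sym (*-identityʳ c)) (≈-trans (*-congˡ (≈-sym uk≈1)) (≈-trans (≈-sym (w≈cu k)) wk≈1))

  SameSpan-zero-one : ∀ {u w} k → u k ≈ 0# → w k ≈ 1# → ¬ SameSpan u w
  SameSpan-zero-one k uk≈0 wk≈1 u~w = 1≉0 (≈-trans (≈-sym wk≈1) (coordinate-≈0-resp k u~w uk≈0))

  SameSpan-one-zero : ∀ {u w} k → u k ≈ 1# → w k ≈ 0# → ¬ SameSpan u w
  SameSpan-one-zero k uk≈1 wk≈0 u~w = SameSpan-zero-one k wk≈0 uk≈1 (SameSpan-sym u~w)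

  point₀ : Fin q → Fin q → Fin q → V
  point₀ a b c = vec 1# (enum a) (enum b) (enum c)

  point₁ : Fin q → Fin q → V
  point₁ b c = vec 0# 1# (enum b) (enum c)

  leading₀ : Vector V (q ℕ.* (q ℕ.* q))
  leading₀ = concat λ a → concat (point₀ a)

  leading₁ : Vector V (q ℕ.* q)
  leading₁ = concat point₁

  leading₂ : Vector V q
  leading₂ c = vec 0# 0# 1# (enum c)

  leading₃ : Vector V 1
  leading₃ _ = vec 0# 0# 0# 1#

  #points : ℕ
  #points = q ℕ.* (q ℕ.* q) ℕ.+ (q ℕ.* q ℕ.+ (q ℕ.+ 1))

  -- Every point has a unique representative whose first nonzero coordinate is 1.
  points : Vector V #points
  points = leading₀ ++ (leading₁ ++ (leading₂ ++ leading₃))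

  apart-at : ∀ {m n} k (f : Vector V m) (g : Vector V n) →
    All (λ v → v k ≈ 1#) f → All (λ v → v k ≈ 0#) g → ∀ i j → ¬ SameSpan (f i) (g j)
  apart-at k f g fk≈1 gk≈0 i j = SameSpan-one-zero k (fk≈1 i) (gk≈0 j)

  leading₀-irredundant : Irredundant leading₀
  leading₀-irredundant = irredundant-concat (λ a → concat (point₀ a)) λ a k a′ k′ s →
    same-block a k a′ k′ s (enum-injective (SameSpan-one-one i₀ s ≈-refl ≈-refl i₁))
    where
    block-irredundant : ∀ a → Irredundant (concat (point₀ a))
    block-irredundant a = irredundant-concat (point₀ a) λ b c b′ c′ s →
      let eq = SameSpan-one-one i₀ s ≈-refl ≈-refl in enum-injective (eq i₂) , enum-injective (eq i₃)
    same-block : ∀ a k a′ k′ → SameSpan (concat (point₀ a) k) (concat (point₀ a′) k′) → a ≡ a′ → a ≡ a′ × k ≡ k′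
    same-block a k .a k′ s refl = refl , block-irredundant a k k′ s

  leading₁-irredundant : Irredundant leading₁
  leading₁-irredundant = irredundant-concat point₁ λ b c b′ c′ s →
    let eq = SameSpan-one-one i₁ s ≈-refl ≈-refl in enum-injective (eq i₂) , enum-injective (eq i₃)

  leading₂-irredundant : Irredundant leading₂
  leading₂-irredundant c c′ s = enum-injective (SameSpan-one-one i₂ s ≈-refl ≈-refl i₃)

  leading₃-irredundant : Irredundant leading₃
  leading₃-irredundant zero zero _ = refl

  points-irredundant : Irredundant points
  points-irredundant =
    irredundant-++ leading₀ _ leading₀-irredundant
      (irredundant-++ leading₁ _ leading₁-irredundant
        (irredundant-++ leading₂ leading₃ leading₂-irredundant leading₃-irredundant
          (apart-at i₂ leading₂ leading₃ (λ _ → ≈-refl) (λ _ → ≈-refl)))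
        (apart-at i₁ leading₁ _ (λ _ → ≈-refl) (All.++⁺ (λ v → v i₁ ≈ 0#) {xs = leading₂} {ys = leading₃} (λ _ → ≈-refl) (λ _ → ≈-refl))))
      (apart-at i₀ leading₀ _ (λ _ → ≈-refl)
        (All.++⁺ (λ v → v i₀ ≈ 0#) {xs = leading₁} (λ _ → ≈-refl)
          (All.++⁺ (λ v → v i₀ ≈ 0#) {xs = leading₂} {ys = leading₃} (λ _ → ≈-refl) (λ _ → ≈-refl))))

  points-nonzero : All NonZeroV points
  points-nonzero = All.++⁺ NonZeroV {xs = leading₀} (λ _ → nonzero-at i₀ 1≉0)
    (All.++⁺ NonZeroV {xs = leading₁} (λ _ → nonzero-at i₁ 1≉0)
      (All.++⁺ NonZeroV {xs = leading₂} {ys = leading₃} (λ _ → nonzero-at i₂ 1≉0) (λ _ → nonzero-at i₃ 1≉0)))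

  points-exhaustive : ∀ w → NonZeroV w → Lists points w
  points-exhaustive w w≉0 with w i₀ ≟F 0#
  ... | no w₀≉0 =
    let (a , ea) = normalised-enum w i₀ i₁ ; (b , eb) = normalised-enum w i₀ i₂ ; (c , ec) = normalised-enum w i₀ i₃ in
    lists-++ˡ leading₀ _ (lists-concat (λ a → concat (point₀ a)) (a , lists-concat (point₀ a) (b , c ,
      normalised-SameSpan i₀ w₀≉0 λ { i₀ → normalised-pivot w i₀ w₀≉0 ; i₁ → ea ; i₂ → eb ; i₃ → ec })))
  ... | yes w₀≈0 with w i₁ ≟F 0#
  ...   | no w₁≉0 =
    let (b , eb) = normalised-enum w i₁ i₂ ; (c , ec) = normalised-enum w i₁ i₃ in
    lists-++ʳ leading₀ _ (lists-++ˡ leading₁ _ (lists-concat point₁ (b , c ,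
      normalised-SameSpan i₁ w₁≉0 λ { i₀ → normalised-zero w i₁ i₀ w₀≈0 ; i₁ → normalised-pivot w i₁ w₁≉0 ; i₂ → eb ; i₃ → ec })))
  ...   | yes w₁≈0 with w i₂ ≟F 0#
  ...     | no w₂≉0 =
    let (c , ec) = normalised-enum w i₂ i₃ in
    lists-++ʳ leading₀ _ (lists-++ʳ leading₁ _ (lists-++ˡ leading₂ leading₃ (c ,
      normalised-SameSpan i₂ w₂≉0 λ { i₀ → normalised-zero w i₂ i₀ w₀≈0 ; i₁ → normalised-zero w i₂ i₁ w₁≈0
                                    ; i₂ → normalised-pivot w i₂ w₂≉0 ; i₃ → ec })))
  ...     | yes w₂≈0 with w i₃ ≟F 0#
  ...       | yes w₃≈0 = ⊥-elim (w≉0 λ { i₀ → w₀≈0 ; i₁ → w₁≈0 ; i₂ → w₂≈0 ; i₃ → w₃≈0 })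
  ...       | no w₃≉0 =
    lists-++ʳ leading₀ _ (lists-++ʳ leading₁ _ (lists-++ʳ leading₂ leading₃ (zero ,
      normalised-SameSpan i₃ w₃≉0 λ { i₀ → normalised-zero w i₃ i₀ w₀≈0 ; i₁ → normalised-zero w i₃ i₁ w₁≈0
                                    ; i₂ → normalised-zero w i₃ i₂ w₂≈0 ; i₃ → normalised-pivot w i₃ w₃≉0 })))

  Π₂-point : Fin q → Fin q → V
  Π₂-point a c = vec 1# (enum a) 0# (enum c)

  pointsOfΠ₂ : Vector V (q ℕ.* q ℕ.+ (q ℕ.+ 1))
  pointsOfΠ₂ = concat Π₂-point ++ ((λ c → vec 0# 1# 0# (enum c)) ++ λ _ → vec 0# 0# 0# 1#)

  pointsOfΠ₂-exhaustive : ∀ w → NonZeroV w → w i₂ ≈ 0# → Lists pointsOfΠ₂ w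
  pointsOfΠ₂-exhaustive w w≉0 w₂≈0 with w i₀ ≟F 0#
  ... | no w₀≉0 =
    let (a , ea) = normalised-enum w i₀ i₁ ; (c , ec) = normalised-enum w i₀ i₃ in
    lists-++ˡ (concat Π₂-point) _ (lists-concat Π₂-point (a , c ,
      normalised-SameSpan i₀ w₀≉0 λ { i₀ → normalised-pivot w i₀ w₀≉0 ; i₁ → ea ; i₂ → normalised-zero w i₀ i₂ w₂≈0 ; i₃ → ec }))
  ... | yes w₀≈0 with w i₁ ≟F 0#
  ...   | no w₁≉0 =
    let (c , ec) = normalised-enum w i₁ i₃ in
    lists-++ʳ (concat Π₂-point) _ (lists-++ˡ _ _ (c ,
      normalised-SameSpan i₁ w₁≉0 λ { i₀ → normalised-zero w i₁ i₀ w₀≈0 ; i₁ → normalised-pivot w i₁ w₁≉0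
                                    ; i₂ → normalised-zero w i₁ i₂ w₂≈0 ; i₃ → ec }))
  ...   | yes w₁≈0 with w i₃ ≟F 0#
  ...     | yes w₃≈0 = ⊥-elim (w≉0 λ { i₀ → w₀≈0 ; i₁ → w₁≈0 ; i₂ → w₂≈0 ; i₃ → w₃≈0 })
  ...     | no w₃≉0 =
    lists-++ʳ (concat Π₂-point) _ (lists-++ʳ _ _ (zero ,
      normalised-SameSpan i₃ w₃≉0 λ { i₀ → normalised-zero w i₃ i₀ w₀≈0 ; i₁ → normalised-zero w i₃ i₁ w₁≈0
                                    ; i₂ → normalised-zero w i₃ i₂ w₂≈0 ; i₃ → normalised-pivot w i₃ w₃≉0 }))

  ContainsAxis : V → Set
  ContainsAxis K = K i₀ ≈ 0# × K i₁ ≈ 0#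

  OffAxis : V → Set
  OffAxis w = ¬ (w i₂ ≈ 0# × w i₃ ≈ 0#)

  pencil₂ : Vector V q
  pencil₂ s = vec 0# 0# 1# (enum s)

  pencil₃ : Vector V 1
  pencil₃ _ = vec 0# 0# 0# 1#

  pencil : Vector V (q ℕ.+ 1)
  pencil = pencil₂ ++ pencil₃

  pencil-irredundant : Irredundant pencil
  pencil-irredundant = irredundant-++ pencil₂ pencil₃
    (λ s s′ K~K′ → enum-injective (SameSpan-one-one i₂ K~K′ ≈-refl ≈-refl i₃))
    (λ { zero zero _ → refl })
    (λ s _ → SameSpan-one-zero i₂ ≈-refl ≈-refl)

  pencil-containsAxis : All ContainsAxis pencil
  pencil-containsAxis = All.++⁺ ContainsAxis {xs = pencil₂} {ys = pencil₃} (λ _ → ≈-refl , ≈-refl) (λ _ → ≈-refl , ≈-refl)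

  pencil-exhaustive : ∀ K → NonZeroV K → ContainsAxis K → Lists pencil K
  pencil-exhaustive K K≉0 (K₀≈0 , K₁≈0) with K i₂ ≟F 0#
  ... | no K₂≉0 =
    let (s , es) = normalised-enum K i₂ i₃ in
    lists-++ˡ pencil₂ pencil₃ (s , normalised-SameSpan i₂ K₂≉0 λ { i₀ → normalised-zero K i₂ i₀ K₀≈0 ; i₁ → normalised-zero K i₂ i₁ K₁≈0
                                                    ; i₂ → normalised-pivot K i₂ K₂≉0 ; i₃ → es })
  ... | yes K₂≈0 with K i₃ ≟F 0#
  ...   | yes K₃≈0 = ⊥-elim (K≉0 λ { i₀ → K₀≈0 ; i₁ → K₁≈0 ; i₂ → K₂≈0 ; i₃ → K₃≈0 })
  ...   | no K₃≉0 =
    lists-++ʳ pencil₂ pencil₃ (zero , normalised-SameSpan i₃ K₃≉0 λ { i₀ → normalised-zero K i₃ i₀ K₀≈0 ; i₁ → normalised-zero K i₃ i₁ K₁≈0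
                                                       ; i₂ → normalised-zero K i₃ i₂ K₂≈0 ; i₃ → normalised-pivot K i₃ K₃≉0 })

  pencil-nonzero : All NonZeroV pencil
  pencil-nonzero = All.++⁺ NonZeroV {xs = pencil₂} {ys = pencil₃} (λ _ → nonzero-at i₂ 1≉0) (λ _ → nonzero-at i₃ 1≉0)

  ⁻¹-cancelʳ : ∀ x {z} → z ≉0 → x * z ⁻¹ * z ≈ x
  ⁻¹-cancelʳ x {z} z≉0 = ≈-trans (*-assoc x _ z) (≈-trans (*-congˡ (⁻¹-inverseˡ z≉0)) (*-identityʳ x))

  containsAxis-dot : ∀ K w → ContainsAxis K → dot K w ≈ K i₂ * w i₂ + K i₃ * w i₃
  containsAxis-dot K w (K₀≈0 , K₁≈0) = begin
    dot K w                              ≈⟨ dot-congˡ {K} {vec 0# 0# (K i₂) (K i₃)} w (λ { i₀ → K₀≈0 ; i₁ → K₁≈0 ; i₂ → ≈-refl ; i₃ → ≈-refl }) ⟩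
    dot (vec 0# 0# (K i₂) (K i₃)) w      ≈⟨ solve 6 (λ w₀ w₁ k₂ w₂ k₃ w₃ → 0ᵉ ⊗ w₀ ⊕ 0ᵉ ⊗ w₁ ⊕ k₂ ⊗ w₂ ⊕ k₃ ⊗ w₃ ⊜ k₂ ⊗ w₂ ⊕ k₃ ⊗ w₃)
                                              ≈-refl (w i₀) (w i₁) (K i₂) (w i₂) (K i₃) (w i₃) ⟩
    K i₂ * w i₂ + K i₃ * w i₃            ∎

  -- The unique plane of the pencil through a point w off the axis.
  axisForm : V → V
  axisForm w = vec 0# 0# (w i₃) (- w i₂)

  axisForm-nonzero : ∀ w → OffAxis w → NonZeroV (axisForm w)
  axisForm-nonzero w w-off A≈0 = w-off (≈-trans (≈-sym (-‿involutive _)) (≈-trans (-‿cong (A≈0 i₃)) -0#≈0#) , A≈0 i₂)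

  axisForm-contains : ∀ w → dot (axisForm w) w ≈ 0#
  axisForm-contains w = solve 4 (λ w₀ w₁ w₂ w₃ → 0ᵉ ⊗ w₀ ⊕ 0ᵉ ⊗ w₁ ⊕ w₃ ⊗ w₂ ⊕ (⊝ w₂) ⊗ w₃ ⊜ 0ᵉ)
    ≈-refl (w i₀) (w i₁) (w i₂) (w i₃)

  pencil-through : ∀ w → OffAxis w → ∃ λ s → dot (pencil s) w ≈ 0#
  pencil-through w w-off =
    let (s , s~A) = pencil-exhaustive (axisForm w) (axisForm-nonzero w w-off) (≈-refl , ≈-refl) in
    s , dot-≈0-respˡ w (SameSpan-sym s~A) (axisForm-contains w)

  axisForm-unique : ∀ K w → NonZeroV K → ContainsAxis K → OffAxis w → dot K w ≈ 0# → SameSpan (axisForm w) K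
  axisForm-unique K w K≉0 K⊇axis@(K₀≈0 , K₁≈0) w-off Kw≈0 with w i₃ ≟F 0#
  ... | no w₃≉0 = SameSpan-multiple (K i₂ * w i₃ ⁻¹) K≉0 λ
    { i₀ → ≈-trans K₀≈0 (≈-sym (zeroʳ _))
    ; i₁ → ≈-trans K₁≈0 (≈-sym (zeroʳ _))
    ; i₂ → ≈-sym (⁻¹-cancelʳ (K i₂) w₃≉0)
    ; i₃ → ≈-sym (begin
        K i₂ * w i₃ ⁻¹ * - w i₂
          ≈⟨ solve 5 (λ k₂ k₃ w₂ w₃ w₃⁻¹ → k₂ ⊗ w₃⁻¹ ⊗ ⊝ w₂ ⊜ k₃ ⊗ (w₃ ⊗ w₃⁻¹) ⊕ ⊝ ((k₂ ⊗ w₂ ⊕ k₃ ⊗ w₃) ⊗ w₃⁻¹))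
               ≈-refl (K i₂) (K i₃) (w i₂) (w i₃) (w i₃ ⁻¹) ⟩
        K i₃ * (w i₃ * w i₃ ⁻¹) - (K i₂ * w i₂ + K i₃ * w i₃) * w i₃ ⁻¹
          ≈⟨ +-cong (*-congˡ (⁻¹-inverseʳ w₃≉0)) (-‿cong (≈-trans (*-congʳ plane-equation) (zeroˡ _))) ⟩
        K i₃ * 1# - 0#
          ≈⟨ solve 1 (λ k → k ⊗ 1ᵉ ⊕ ⊝ 0ᵉ ⊜ k) ≈-refl (K i₃) ⟩
        K i₃ ∎) }
    where
    plane-equation : K i₂ * w i₂ + K i₃ * w i₃ ≈ 0#
    plane-equation = ≈-trans (≈-sym (containsAxis-dot K w K⊇axis)) Kw≈0
  ... | yes w₃≈0 = SameSpan-multiple (- K i₃ * w i₂ ⁻¹) K≉0 λ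
    { i₀ → ≈-trans K₀≈0 (≈-sym (zeroʳ _))
    ; i₁ → ≈-trans K₁≈0 (≈-sym (zeroʳ _))
    ; i₂ → ≈-trans K₂≈0 (≈-sym (≈-trans (*-congˡ w₃≈0) (zeroʳ _)))
    ; i₃ → ≈-sym (begin
        - K i₃ * w i₂ ⁻¹ * - w i₂   ≈⟨ solve 3 (λ k w i → ⊝ k ⊗ i ⊗ ⊝ w ⊜ k ⊗ i ⊗ w) ≈-refl (K i₃) (w i₂) (w i₂ ⁻¹) ⟩
        K i₃ * w i₂ ⁻¹ * w i₂       ≈⟨ ⁻¹-cancelʳ (K i₃) w₂≉0 ⟩
        K i₃                        ∎) }
    where
    w₂≉0 : w i₂ ≉0
    w₂≉0 w₂≈0 = w-off (w₂≈0 , w₃≈0)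
    K₂≈0 : K i₂ ≈ 0#
    K₂≈0 = cancel-nonzeroˡ (begin
      w i₂ * K i₂                   ≈⟨ solve 4 (λ k₂ w₂ k₃ w₃ → w₂ ⊗ k₂ ⊜ (k₂ ⊗ w₂ ⊕ k₃ ⊗ w₃) ⊕ ⊝ (k₃ ⊗ w₃))
                                          ≈-refl (K i₂) (w i₂) (K i₃) (w i₃) ⟩
      (K i₂ * w i₂ + K i₃ * w i₃) - K i₃ * w i₃
        ≈⟨ +-cong (≈-trans (≈-sym (containsAxis-dot K w K⊇axis)) Kw≈0) (-‿cong (≈-trans (*-congˡ w₃≈0) (zeroʳ _))) ⟩
      0# - 0#                       ≈⟨ solve 0 (0ᵉ ⊕ ⊝ 0ᵉ ⊜ 0ᵉ) ≈-refl ⟩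
      0#                            ∎) w₂≉0

  e₂ : V
  e₂ = vec 0# 0# 1# 0#

  e₃ : V
  e₃ = vec 0# 0# 0# 1#

  dot-e₂ : ∀ w → dot e₂ w ≈ w i₂
  dot-e₂ w = solve 4 (λ w₀ w₁ w₂ w₃ → 0ᵉ ⊗ w₀ ⊕ 0ᵉ ⊗ w₁ ⊕ 1ᵉ ⊗ w₂ ⊕ 0ᵉ ⊗ w₃ ⊜ w₂) ≈-refl (w i₀) (w i₁) (w i₂) (w i₃)

  dot-e₃ : ∀ w → dot e₃ w ≈ w i₃
  dot-e₃ w = solve 4 (λ w₀ w₁ w₂ w₃ → 0ᵉ ⊗ w₀ ⊕ 0ᵉ ⊗ w₁ ⊕ 0ᵉ ⊗ w₂ ⊕ 1ᵉ ⊗ w₃ ⊜ w₃) ≈-refl (w i₀) (w i₁) (w i₂) (w i₃)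

  -- A coordinate other than the second one at which a plane K ≠ Π₂ is nonzero;
  -- it lets us solve the equation of K for that coordinate.
  Pivot₀₁₃ : V → Set
  Pivot₀₁₃ K = K i₀ ≉0 ⊎ (K i₁ ≉0 ⊎ K i₃ ≉0)

  pivot₀₁₃ : ∀ K → NonZeroV K → ¬ SameSpan e₂ K → Pivot₀₁₃ K
  pivot₀₁₃ K K≉0 K≁e₂ with K i₀ ≟F 0# | K i₁ ≟F 0# | K i₃ ≟F 0#
  ... | no K₀≉0 | _       | _       = inj₁ K₀≉0
  ... | yes _   | no K₁≉0 | _       = inj₂ (inj₁ K₁≉0)
  ... | yes _   | yes _   | no K₃≉0 = inj₂ (inj₂ K₃≉0)
  ... | yes K₀≈0 | yes K₁≈0 | yes K₃≈0 = ⊥-elim (K≁e₂ (SameSpan-multiple (K i₂) K≉0 λ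
    { i₀ → ≈-trans K₀≈0 (≈-sym (zeroʳ _)) ; i₁ → ≈-trans K₁≈0 (≈-sym (zeroʳ _))
    ; i₂ → ≈-sym (*-identityʳ _)          ; i₃ → ≈-trans K₃≈0 (≈-sym (zeroʳ _)) }))

  -- The q² points of the plane K off Π₂, scaled to second coordinate 1.
  affinePoints : (K : V) → Pivot₀₁₃ K → Fin q → Fin q → V
  affinePoints K (inj₁ _)        s t = vec ((- (K i₁ * enum s + K i₂ + K i₃ * enum t)) * K i₀ ⁻¹) (enum s) 1# (enum t)
  affinePoints K (inj₂ (inj₁ _)) s t = vec (enum s) ((- (K i₀ * enum s + K i₂ + K i₃ * enum t)) * K i₁ ⁻¹) 1# (enum t)
  affinePoints K (inj₂ (inj₂ _)) s t = vec (enum s) (enum t) 1# ((- (K i₀ * enum s + K i₁ * enum t + K i₂)) * K i₃ ⁻¹)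

  meets-Π₃-off-Π₂ : ∀ K → K i₀ ≉0 ⊎ K i₁ ≉0 → ∃ λ w → w i₂ ≈ 1# × w i₃ ≈ 0# × dot K w ≈ 0#
  meets-Π₃-off-Π₂ K (inj₁ K₀≉0) = vec ((- K i₂) * K i₀ ⁻¹) 0# 1# 0# , ≈-refl , ≈-refl , (begin
    K i₀ * ((- K i₂) * K i₀ ⁻¹) + K i₁ * 0# + K i₂ * 1# + K i₃ * 0#
      ≈⟨ solve 5 (λ k₀ k₁ k₂ k₃ i → k₀ ⊗ ((⊝ k₂) ⊗ i) ⊕ k₁ ⊗ 0ᵉ ⊕ k₂ ⊗ 1ᵉ ⊕ k₃ ⊗ 0ᵉ ⊜ k₂ ⊗ (1ᵉ ⊕ ⊝ (k₀ ⊗ i)))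
           ≈-refl (K i₀) (K i₁) (K i₂) (K i₃) (K i₀ ⁻¹) ⟩
    K i₂ * (1# - K i₀ * K i₀ ⁻¹)   ≈⟨ *-congˡ (+-congˡ (-‿cong (⁻¹-inverseʳ K₀≉0))) ⟩
    K i₂ * (1# - 1#)               ≈⟨ solve 1 (λ k → k ⊗ (1ᵉ ⊕ ⊝ 1ᵉ) ⊜ 0ᵉ) ≈-refl (K i₂) ⟩
    0#                             ∎)
  meets-Π₃-off-Π₂ K (inj₂ K₁≉0) = vec 0# ((- K i₂) * K i₁ ⁻¹) 1# 0# , ≈-refl , ≈-refl , (begin
    K i₀ * 0# + K i₁ * ((- K i₂) * K i₁ ⁻¹) + K i₂ * 1# + K i₃ * 0#
      ≈⟨ solve 5 (λ k₀ k₁ k₂ k₃ i → k₀ ⊗ 0ᵉ ⊕ k₁ ⊗ ((⊝ k₂) ⊗ i) ⊕ k₂ ⊗ 1ᵉ ⊕ k₃ ⊗ 0ᵉ ⊜ k₂ ⊗ (1ᵉ ⊕ ⊝ (k₁ ⊗ i)))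
           ≈-refl (K i₀) (K i₁) (K i₂) (K i₃) (K i₁ ⁻¹) ⟩
    K i₂ * (1# - K i₁ * K i₁ ⁻¹)   ≈⟨ *-congˡ (+-congˡ (-‿cong (⁻¹-inverseʳ K₁≉0))) ⟩
    K i₂ * (1# - 1#)               ≈⟨ solve 1 (λ k → k ⊗ (1ᵉ ⊕ ⊝ 1ᵉ) ⊜ 0ᵉ) ≈-refl (K i₂) ⟩
    0#                             ∎)

  solve-linear : ∀ {p x r} → p ≉0 → p * x + r ≈ 0# → (- r) * p ⁻¹ ≈ x
  solve-linear {p} {x} {r} p≉0 px+r≈0 = begin
    (- r) * p ⁻¹                               ≈⟨ solve 4 (λ p p⁻¹ x r → (⊝ r) ⊗ p⁻¹ ⊜ (⊝ (p ⊗ x ⊕ r)) ⊗ p⁻¹ ⊕ x ⊗ (p ⊗ p⁻¹))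
                                                    ≈-refl p (p ⁻¹) x r ⟩
    (- (p * x + r)) * p ⁻¹ + x * (p * p ⁻¹)    ≈⟨ +-cong (*-congʳ (-‿cong px+r≈0)) (*-congˡ (⁻¹-inverseʳ p≉0)) ⟩
    (- 0#) * p ⁻¹ + x * 1#                     ≈⟨ solve 2 (λ p⁻¹ x → (⊝ 0ᵉ) ⊗ p⁻¹ ⊕ x ⊗ 1ᵉ ⊜ x) ≈-refl (p ⁻¹) x ⟩
    x                                          ∎

  module _ (K w : V) (Kw≈0 : dot K w ≈ 0#) (w₂≉0 : w i₂ ≉0) where

    private
      w′ : V
      w′ i = w i * w i₂ ⁻¹

      equation : K i₀ * w′ i₀ + K i₁ * w′ i₁ + K i₂ + K i₃ * w′ i₃ ≈ 0#
      equation = begin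
        K i₀ * w′ i₀ + K i₁ * w′ i₁ + K i₂ + K i₃ * w′ i₃
          ≈⟨ solve 9 (λ k₀ k₁ k₂ k₃ w₀ w₁ w₂ w₃ i →
               k₀ ⊗ (w₀ ⊗ i) ⊕ k₁ ⊗ (w₁ ⊗ i) ⊕ k₂ ⊕ k₃ ⊗ (w₃ ⊗ i) ⊜
               (k₀ ⊗ w₀ ⊕ k₁ ⊗ w₁ ⊕ k₂ ⊗ w₂ ⊕ k₃ ⊗ w₃) ⊗ i ⊕ k₂ ⊗ (1ᵉ ⊕ ⊝ (w₂ ⊗ i)))
               ≈-refl (K i₀) (K i₁) (K i₂) (K i₃) (w i₀) (w i₁) (w i₂) (w i₃) (w i₂ ⁻¹) ⟩
        dot K w * w i₂ ⁻¹ + K i₂ * (1# - w i₂ * w i₂ ⁻¹)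
          ≈⟨ +-cong (*-congʳ Kw≈0) (*-congˡ (+-congˡ (-‿cong (⁻¹-inverseʳ w₂≉0)))) ⟩
        0# * w i₂ ⁻¹ + K i₂ * (1# - 1#)
          ≈⟨ solve 2 (λ a b → 0ᵉ ⊗ a ⊕ b ⊗ (1ᵉ ⊕ ⊝ 1ᵉ) ⊜ 0ᵉ) ≈-refl (w i₂ ⁻¹) (K i₂) ⟩
        0# ∎

    affinePoints-exhaustive : ∀ p → ∃ λ s → ∃ λ t → SameSpan (affinePoints K p s t) w
    affinePoints-exhaustive (inj₁ K₀≉0) =
      let (s , es) = normalised-enum w i₂ i₁ ; (t , et) = normalised-enum w i₂ i₃ in
      s , t , normalised-SameSpan i₂ w₂≉0 λ
        { i₀ → solve-linear K₀≉0 (≈-trans (+-congˡ (+-cong (+-congʳ (*-congˡ es)) (*-congˡ et)))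
                 (≈-trans (solve 4 (λ a b c d → a ⊕ (b ⊕ c ⊕ d) ⊜ a ⊕ b ⊕ c ⊕ d) ≈-refl _ _ _ _) equation))
        ; i₁ → es ; i₂ → normalised-pivot w i₂ w₂≉0 ; i₃ → et }
    affinePoints-exhaustive (inj₂ (inj₁ K₁≉0)) =
      let (s , es) = normalised-enum w i₂ i₀ ; (t , et) = normalised-enum w i₂ i₃ in
      s , t , normalised-SameSpan i₂ w₂≉0 λ
        { i₀ → es
        ; i₁ → solve-linear K₁≉0 (≈-trans (+-congˡ (+-cong (+-congʳ (*-congˡ es)) (*-congˡ et)))
                 (≈-trans (solve 4 (λ b a c d → b ⊕ (a ⊕ c ⊕ d) ⊜ a ⊕ b ⊕ c ⊕ d) ≈-refl _ _ _ _) equation))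
        ; i₂ → normalised-pivot w i₂ w₂≉0 ; i₃ → et }
    affinePoints-exhaustive (inj₂ (inj₂ K₃≉0)) =
      let (s , es) = normalised-enum w i₂ i₀ ; (t , et) = normalised-enum w i₂ i₁ in
      s , t , normalised-SameSpan i₂ w₂≉0 λ
        { i₀ → es ; i₁ → et ; i₂ → normalised-pivot w i₂ w₂≉0
        ; i₃ → solve-linear K₃≉0 (≈-trans (+-congˡ (+-congʳ (+-cong (*-congˡ es) (*-congˡ et))))
                 (≈-trans (solve 4 (λ d a b c → d ⊕ (a ⊕ b ⊕ c) ⊜ a ⊕ b ⊕ c ⊕ d) ≈-refl _ _ _ _) equation)) }

  -- Dual bases and changes of coordinates

  unit : Fin 4 → V
  unit i₀ = vec 1# 0# 0# 0#
  unit i₁ = vec 0# 1# 0# 0#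
  unit i₂ = vec 0# 0# 1# 0#
  unit i₃ = vec 0# 0# 0# 1#

  dot-unitʳ : ∀ x k → dot x (unit k) ≈ x k
  dot-unitʳ x i₀ = solve 4 (λ a b c d → a ⊗ 1ᵉ ⊕ b ⊗ 0ᵉ ⊕ c ⊗ 0ᵉ ⊕ d ⊗ 0ᵉ ⊜ a) ≈-refl (x i₀) (x i₁) (x i₂) (x i₃)
  dot-unitʳ x i₁ = solve 4 (λ a b c d → a ⊗ 0ᵉ ⊕ b ⊗ 1ᵉ ⊕ c ⊗ 0ᵉ ⊕ d ⊗ 0ᵉ ⊜ b) ≈-refl (x i₀) (x i₁) (x i₂) (x i₃)
  dot-unitʳ x i₂ = solve 4 (λ a b c d → a ⊗ 0ᵉ ⊕ b ⊗ 0ᵉ ⊕ c ⊗ 1ᵉ ⊕ d ⊗ 0ᵉ ⊜ c) ≈-refl (x i₀) (x i₁) (x i₂) (x i₃)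
  dot-unitʳ x i₃ = solve 4 (λ a b c d → a ⊗ 0ᵉ ⊕ b ⊗ 0ᵉ ⊕ c ⊗ 0ᵉ ⊕ d ⊗ 1ᵉ ⊜ d) ≈-refl (x i₀) (x i₁) (x i₂) (x i₃)

  dot-unitˡ : ∀ x k → dot (unit k) x ≈ x k
  dot-unitˡ x k = ≈-trans (dot-comm (unit k) x) (dot-unitʳ x k)

  unit-sym : ∀ i j → unit i j ≈ unit j i
  unit-sym i₀ i₀ = ≈-refl
  unit-sym i₀ i₁ = ≈-refl
  unit-sym i₀ i₂ = ≈-refl
  unit-sym i₀ i₃ = ≈-refl
  unit-sym i₁ i₀ = ≈-refl
  unit-sym i₁ i₁ = ≈-refl
  unit-sym i₁ i₂ = ≈-refl
  unit-sym i₁ i₃ = ≈-refl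
  unit-sym i₂ i₀ = ≈-refl
  unit-sym i₂ i₁ = ≈-refl
  unit-sym i₂ i₂ = ≈-refl
  unit-sym i₂ i₃ = ≈-refl
  unit-sym i₃ i₀ = ≈-refl
  unit-sym i₃ i₁ = ≈-refl
  unit-sym i₃ i₂ = ≈-refl
  unit-sym i₃ i₃ = ≈-refl

  -- The two indices other than k and l.
  record Complement (k l : Fin 4) : Set where
    field
      m n         : Fin 4
      sum-reorder : ∀ (t : Fin 4 → F) → t i₀ + t i₁ + t i₂ + t i₃ ≈ t k + t l + t m + t n
      unit-km     : unit k m ≈ 0#
      unit-kn     : unit k n ≈ 0#
      unit-lm     : unit l m ≈ 0#
      unit-ln     : unit l n ≈ 0#
      unit-mm     : unit m m ≈ 1#
      unit-nn     : unit n n ≈ 1#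
      unit-mn     : unit m n ≈ 0#
      unit-nm     : unit n m ≈ 0#

  complement : ∀ k l → k ≢ l → Complement k l
  complement i₀ i₀ k≢l = ⊥-elim (k≢l refl)
  complement i₁ i₁ k≢l = ⊥-elim (k≢l refl)
  complement i₂ i₂ k≢l = ⊥-elim (k≢l refl)
  complement i₃ i₃ k≢l = ⊥-elim (k≢l refl)
  complement i₀ i₁ _ = record { m = i₂ ; n = i₃
    ; sum-reorder = λ t → solve 4 (λ a b c d → a ⊕ b ⊕ c ⊕ d ⊜ a ⊕ b ⊕ c ⊕ d) ≈-refl (t i₀) (t i₁) (t i₂) (t i₃)
    ; unit-km = ≈-refl ; unit-kn = ≈-refl ; unit-lm = ≈-refl ; unit-ln = ≈-refl
    ; unit-mm = ≈-refl ; unit-nn = ≈-refl ; unit-mn = ≈-refl ; unit-nm = ≈-refl }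
  complement i₀ i₂ _ = record { m = i₁ ; n = i₃
    ; sum-reorder = λ t → solve 4 (λ a b c d → a ⊕ b ⊕ c ⊕ d ⊜ a ⊕ c ⊕ b ⊕ d) ≈-refl (t i₀) (t i₁) (t i₂) (t i₃)
    ; unit-km = ≈-refl ; unit-kn = ≈-refl ; unit-lm = ≈-refl ; unit-ln = ≈-refl
    ; unit-mm = ≈-refl ; unit-nn = ≈-refl ; unit-mn = ≈-refl ; unit-nm = ≈-refl }
  complement i₀ i₃ _ = record { m = i₁ ; n = i₂
    ; sum-reorder = λ t → solve 4 (λ a b c d → a ⊕ b ⊕ c ⊕ d ⊜ a ⊕ d ⊕ b ⊕ c) ≈-refl (t i₀) (t i₁) (t i₂) (t i₃)
    ; unit-km = ≈-refl ; unit-kn = ≈-refl ; unit-lm = ≈-refl ; unit-ln = ≈-refl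
    ; unit-mm = ≈-refl ; unit-nn = ≈-refl ; unit-mn = ≈-refl ; unit-nm = ≈-refl }
  complement i₁ i₀ _ = record { m = i₂ ; n = i₃
    ; sum-reorder = λ t → solve 4 (λ a b c d → a ⊕ b ⊕ c ⊕ d ⊜ b ⊕ a ⊕ c ⊕ d) ≈-refl (t i₀) (t i₁) (t i₂) (t i₃)
    ; unit-km = ≈-refl ; unit-kn = ≈-refl ; unit-lm = ≈-refl ; unit-ln = ≈-refl
    ; unit-mm = ≈-refl ; unit-nn = ≈-refl ; unit-mn = ≈-refl ; unit-nm = ≈-refl }
  complement i₁ i₂ _ = record { m = i₀ ; n = i₃
    ; sum-reorder = λ t → solve 4 (λ a b c d → a ⊕ b ⊕ c ⊕ d ⊜ b ⊕ c ⊕ a ⊕ d) ≈-refl (t i₀) (t i₁) (t i₂) (t i₃)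
    ; unit-km = ≈-refl ; unit-kn = ≈-refl ; unit-lm = ≈-refl ; unit-ln = ≈-refl
    ; unit-mm = ≈-refl ; unit-nn = ≈-refl ; unit-mn = ≈-refl ; unit-nm = ≈-refl }
  complement i₁ i₃ _ = record { m = i₀ ; n = i₂
    ; sum-reorder = λ t → solve 4 (λ a b c d → a ⊕ b ⊕ c ⊕ d ⊜ b ⊕ d ⊕ a ⊕ c) ≈-refl (t i₀) (t i₁) (t i₂) (t i₃)
    ; unit-km = ≈-refl ; unit-kn = ≈-refl ; unit-lm = ≈-refl ; unit-ln = ≈-refl
    ; unit-mm = ≈-refl ; unit-nn = ≈-refl ; unit-mn = ≈-refl ; unit-nm = ≈-refl }
  complement i₂ i₀ _ = record { m = i₁ ; n = i₃
    ; sum-reorder = λ t → solve 4 (λ a b c d → a ⊕ b ⊕ c ⊕ d ⊜ c ⊕ a ⊕ b ⊕ d) ≈-refl (t i₀) (t i₁) (t i₂) (t i₃)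
    ; unit-km = ≈-refl ; unit-kn = ≈-refl ; unit-lm = ≈-refl ; unit-ln = ≈-refl
    ; unit-mm = ≈-refl ; unit-nn = ≈-refl ; unit-mn = ≈-refl ; unit-nm = ≈-refl }
  complement i₂ i₁ _ = record { m = i₀ ; n = i₃
    ; sum-reorder = λ t → solve 4 (λ a b c d → a ⊕ b ⊕ c ⊕ d ⊜ c ⊕ b ⊕ a ⊕ d) ≈-refl (t i₀) (t i₁) (t i₂) (t i₃)
    ; unit-km = ≈-refl ; unit-kn = ≈-refl ; unit-lm = ≈-refl ; unit-ln = ≈-refl
    ; unit-mm = ≈-refl ; unit-nn = ≈-refl ; unit-mn = ≈-refl ; unit-nm = ≈-refl }
  complement i₂ i₃ _ = record { m = i₀ ; n = i₁
    ; sum-reorder = λ t → solve 4 (λ a b c d → a ⊕ b ⊕ c ⊕ d ⊜ c ⊕ d ⊕ a ⊕ b) ≈-refl (t i₀) (t i₁) (t i₂) (t i₃)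
    ; unit-km = ≈-refl ; unit-kn = ≈-refl ; unit-lm = ≈-refl ; unit-ln = ≈-refl
    ; unit-mm = ≈-refl ; unit-nn = ≈-refl ; unit-mn = ≈-refl ; unit-nm = ≈-refl }
  complement i₃ i₀ _ = record { m = i₁ ; n = i₂
    ; sum-reorder = λ t → solve 4 (λ a b c d → a ⊕ b ⊕ c ⊕ d ⊜ d ⊕ a ⊕ b ⊕ c) ≈-refl (t i₀) (t i₁) (t i₂) (t i₃)
    ; unit-km = ≈-refl ; unit-kn = ≈-refl ; unit-lm = ≈-refl ; unit-ln = ≈-refl
    ; unit-mm = ≈-refl ; unit-nn = ≈-refl ; unit-mn = ≈-refl ; unit-nm = ≈-refl }
  complement i₃ i₁ _ = record { m = i₀ ; n = i₂
    ; sum-reorder = λ t → solve 4 (λ a b c d → a ⊕ b ⊕ c ⊕ d ⊜ d ⊕ b ⊕ a ⊕ c) ≈-refl (t i₀) (t i₁) (t i₂) (t i₃)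
    ; unit-km = ≈-refl ; unit-kn = ≈-refl ; unit-lm = ≈-refl ; unit-ln = ≈-refl
    ; unit-mm = ≈-refl ; unit-nn = ≈-refl ; unit-mn = ≈-refl ; unit-nm = ≈-refl }
  complement i₃ i₂ _ = record { m = i₀ ; n = i₁
    ; sum-reorder = λ t → solve 4 (λ a b c d → a ⊕ b ⊕ c ⊕ d ⊜ d ⊕ c ⊕ a ⊕ b) ≈-refl (t i₀) (t i₁) (t i₂) (t i₃)
    ; unit-km = ≈-refl ; unit-kn = ≈-refl ; unit-lm = ≈-refl ; unit-ln = ≈-refl
    ; unit-mm = ≈-refl ; unit-nn = ≈-refl ; unit-mn = ≈-refl ; unit-nm = ≈-refl }

  Σ₄ : (Fin 4 → F) → F
  Σ₄ t = t i₀ + (t i₁ + (t i₂ + t i₃))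

  Σ₄-cong : ∀ (s t : Fin 4 → F) → (∀ j → s j ≈ t j) → Σ₄ s ≈ Σ₄ t
  Σ₄-cong _ _ s≈t = +-cong (s≈t i₀) (+-cong (s≈t i₁) (+-cong (s≈t i₂) (s≈t i₃)))

  lincomb : (Fin 4 → V) → V → V
  lincomb B c t = Σ₄ λ j → c j * B j t

  Σ₄-unit : ∀ (c : V) j → (Σ₄ λ i → c i * unit i j) ≈ c j
  Σ₄-unit c i₀ = solve 4 (λ a b d f → a ⊗ 1ᵉ ⊕ (b ⊗ 0ᵉ ⊕ (d ⊗ 0ᵉ ⊕ f ⊗ 0ᵉ)) ⊜ a) ≈-refl (c i₀) (c i₁) (c i₂) (c i₃)
  Σ₄-unit c i₁ = solve 4 (λ a b d f → a ⊗ 0ᵉ ⊕ (b ⊗ 1ᵉ ⊕ (d ⊗ 0ᵉ ⊕ f ⊗ 0ᵉ)) ⊜ b) ≈-refl (c i₀) (c i₁) (c i₂) (c i₃)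
  Σ₄-unit c i₂ = solve 4 (λ a b d f → a ⊗ 0ᵉ ⊕ (b ⊗ 0ᵉ ⊕ (d ⊗ 1ᵉ ⊕ f ⊗ 0ᵉ)) ⊜ d) ≈-refl (c i₀) (c i₁) (c i₂) (c i₃)
  Σ₄-unit c i₃ = solve 4 (λ a b d f → a ⊗ 0ᵉ ⊕ (b ⊗ 0ᵉ ⊕ (d ⊗ 0ᵉ ⊕ f ⊗ 1ᵉ)) ⊜ f) ≈-refl (c i₀) (c i₁) (c i₂) (c i₃)

  vadd : V → V → V
  vadd u w t = u t + w t

  dot-vaddʳ : ∀ x u w → dot x (vadd u w) ≈ dot x u + dot x w
  dot-vaddʳ x u w = solve 12 (λ x₀ x₁ x₂ x₃ u₀ u₁ u₂ u₃ w₀ w₁ w₂ w₃ →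
     x₀ ⊗ (u₀ ⊕ w₀) ⊕ x₁ ⊗ (u₁ ⊕ w₁) ⊕ x₂ ⊗ (u₂ ⊕ w₂) ⊕ x₃ ⊗ (u₃ ⊕ w₃)
     ⊜ (x₀ ⊗ u₀ ⊕ x₁ ⊗ u₁ ⊕ x₂ ⊗ u₂ ⊕ x₃ ⊗ u₃) ⊕ (x₀ ⊗ w₀ ⊕ x₁ ⊗ w₁ ⊕ x₂ ⊗ w₂ ⊕ x₃ ⊗ w₃))
     ≈-refl (x i₀) (x i₁) (x i₂) (x i₃) (u i₀) (u i₁) (u i₂) (u i₃) (w i₀) (w i₁) (w i₂) (w i₃)

  dot-Σ₄ : ∀ (x : V) (u : Fin 4 → V) → dot x (λ t → Σ₄ λ j → u j t) ≈ Σ₄ λ j → dot x (u j)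
  dot-Σ₄ x u = ≈-trans (dot-vaddʳ x (u i₀) (λ t → u i₁ t + (u i₂ t + u i₃ t)))
    (+-congˡ (≈-trans (dot-vaddʳ x (u i₁) (λ t → u i₂ t + u i₃ t)) (+-congˡ (dot-vaddʳ x (u i₂) (u i₃)))))

  dot-lincombʳ : ∀ x B c → dot x (lincomb B c) ≈ Σ₄ λ j → c j * dot x (B j)
  dot-lincombʳ x B c = ≈-trans (dot-Σ₄ x λ j → scale (c j) (B j)) (Σ₄-cong _ (λ j → c j * dot x (B j)) λ j → dot-scaleʳ x (c j) (B j))

  dot-lincombˡ : ∀ x B c → dot (lincomb B c) x ≈ Σ₄ λ j → c j * dot (B j) x
  dot-lincombˡ x B c = ≈-trans (dot-comm (lincomb B c) x) (≈-trans (dot-lincombʳ x B c) (Σ₄-cong _ (λ j → c j * dot (B j) x) λ j → *-congˡ (dot-comm x (B j))))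

  lincomb-cong : ∀ B {c c′} → c ≋ c′ → lincomb B c ≋ lincomb B c′
  lincomb-cong B {c} {c′} c≋c′ t = Σ₄-cong (λ j → c j * B j t) (λ j → c′ j * B j t) λ j → *-congʳ (c≋c′ j)

  lincomb-scale : ∀ B c x → lincomb B (scale c x) ≋ scale c (lincomb B x)
  lincomb-scale B c x t = solve 9 (λ c x₀ x₁ x₂ x₃ b₀ b₁ b₂ b₃ →
     (c ⊗ x₀) ⊗ b₀ ⊕ ((c ⊗ x₁) ⊗ b₁ ⊕ ((c ⊗ x₂) ⊗ b₂ ⊕ (c ⊗ x₃) ⊗ b₃)) ⊜ c ⊗ (x₀ ⊗ b₀ ⊕ (x₁ ⊗ b₁ ⊕ (x₂ ⊗ b₂ ⊕ x₃ ⊗ b₃))))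
     ≈-refl c (x i₀) (x i₁) (x i₂) (x i₃) (B i₀ t) (B i₁ t) (B i₂ t) (B i₃ t)

  zeroV : V
  zeroV _ = 0#

  lincomb-zero : ∀ B {c} → c ≋ zeroV → lincomb B c ≋ zeroV
  lincomb-zero B {c} c≈0 t = ≈-trans (lincomb-cong B {c} {zeroV} c≈0 t)
    (solve 4 (λ b₀ b₁ b₂ b₃ → 0ᵉ ⊗ b₀ ⊕ (0ᵉ ⊗ b₁ ⊕ (0ᵉ ⊗ b₂ ⊕ 0ᵉ ⊗ b₃)) ⊜ 0ᵉ) ≈-refl (B i₀ t) (B i₁ t) (B i₂ t) (B i₃ t))

  dot-zeroʳ : ∀ K {x} → x ≋ zeroV → dot K x ≈ 0#
  dot-zeroʳ K {x} x≈0 = ≈-trans (dot-congʳ K x≈0)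
    (solve 4 (λ k₀ k₁ k₂ k₃ → k₀ ⊗ 0ᵉ ⊕ k₁ ⊗ 0ᵉ ⊕ k₂ ⊗ 0ᵉ ⊕ k₃ ⊗ 0ᵉ ⊜ 0ᵉ) ≈-refl (K i₀) (K i₁) (K i₂) (K i₃))

  dot-zeroˡ : ∀ {K} x → K ≋ zeroV → dot K x ≈ 0#
  dot-zeroˡ {K} x K≈0 = ≈-trans (dot-comm K x) (dot-zeroʳ x K≈0)

  cancel-by-inverse : ∀ x y i → i * y ≈ 1# → x + (- (x * i)) * y ≈ 0#
  cancel-by-inverse x y i e = begin
    x + (- (x * i)) * y ≈⟨ solve 3 (λ x y i → x ⊕ (⊝ (x ⊗ i)) ⊗ y ⊜ x ⊗ (1ᵉ ⊕ ⊝ (i ⊗ y))) ≈-refl x y i ⟩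
    x * (1# - i * y) ≈⟨ *-congˡ (+-congˡ (-‿cong e)) ⟩
    x * (1# - 1#) ≈⟨ solve 1 (λ x → x ⊗ (1ᵉ ⊕ ⊝ 1ᵉ) ⊜ 0ᵉ) ≈-refl x ⟩
    0# ∎

  record DualBases (a b : V) : Set where
    field
      form basis : Fin 4 → V
      form₂ : form i₂ ≡ a
      form₃ : form i₃ ≡ b
      duality : ∀ i j → dot (form i) (basis j) ≈ unit i j
      expansion : ∀ w t → w t ≈ lincomb basis (λ j → dot (form j) w) t

  -- a and b are completed by the coordinate forms of the two indices m, n other than the pivot
  -- k of a and the pivot l of b − ρ a.  The dual vectors g₂, g₃ of a, b lie in the span of
  -- unit k and unit l, and those of unit m, unit n are unit m, unit n projected along g₂, g₃.
  module DualBasesExtending (a b : V) (a≉0 : NonZeroV a) (b≉0 : NonZeroV b) (a≁b : ¬ SameSpan a b) where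

    k : Fin 4
    k = proj₁ (nonzero-coordinate a≉0)

    aₖ≉0 : a k ≉0
    aₖ≉0 = proj₂ (nonzero-coordinate a≉0)

    ρ : F
    ρ = b k * a k ⁻¹

    b′ : V
    b′ i = b i + (- ρ) * a i

    b′ₖ≈0 : b′ k ≈ 0#
    b′ₖ≈0 = cancel-by-inverse (b k) (a k) (a k ⁻¹) (⁻¹-inverseˡ aₖ≉0)

    b′≉0 : NonZeroV b′
    b′≉0 b′≈0 = a≁b (SameSpan-multiple ρ b≉0 b≈ρa)
      where
      b≈ρa : ∀ i → b i ≈ ρ * a i
      b≈ρa i = begin
        b i              ≈⟨ solve 3 (λ bᵢ r aᵢ → bᵢ ⊜ (bᵢ ⊕ (⊝ r) ⊗ aᵢ) ⊕ r ⊗ aᵢ) ≈-refl (b i) ρ (a i) ⟩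
        b′ i + ρ * a i   ≈⟨ +-congʳ (b′≈0 i) ⟩
        0# + ρ * a i     ≈⟨ +-identityˡ _ ⟩
        ρ * a i          ∎

    l : Fin 4
    l = proj₁ (nonzero-coordinate b′≉0)

    b′ₗ≉0 : b′ l ≉0
    b′ₗ≉0 = proj₂ (nonzero-coordinate b′≉0)

    k≢l : k ≢ l
    k≢l k≡l = b′ₗ≉0 (subst (λ j → b′ j ≈ 0#) k≡l b′ₖ≈0)

    open Complement (complement k l k≢l)

    α β : F
    α = a l * a k ⁻¹
    β = b′ l ⁻¹

    g₃ : V
    g₃ = scale β (lin 1# (unit l) (- α) (unit k))

    g₂ : V
    g₂ = lin (a k ⁻¹) (unit k) (- ρ) g₃

    project : V → V
    project w t = w t + (- dot a w) * g₂ t + (- dot b w) * g₃ t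

    dot-g₃ : ∀ x → dot x g₃ ≈ β * (x l + (- α) * x k)
    dot-g₃ x = ≈-trans (dot-scaleʳ x β (lin 1# (unit l) (- α) (unit k))) (*-congˡ (≈-trans (dot-lin x 1# (unit l) (- α) (unit k))
      (+-cong (≈-trans (*-identityˡ _) (dot-unitʳ x l)) (*-congˡ (dot-unitʳ x k)))))

    dot-g₂ : ∀ x → dot x g₂ ≈ a k ⁻¹ * x k + (- ρ) * dot x g₃
    dot-g₂ x = ≈-trans (dot-lin x (a k ⁻¹) (unit k) (- ρ) g₃) (+-congʳ (*-congˡ (dot-unitʳ x k)))

    a·g₃≈0 : dot a g₃ ≈ 0#
    a·g₃≈0 = ≈-trans (dot-g₃ a) (≈-trans (*-congˡ (cancel-by-inverse (a l) (a k) (a k ⁻¹) (⁻¹-inverseˡ aₖ≉0))) (zeroʳ β))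

    b·g₃≈1 : dot b g₃ ≈ 1#
    b·g₃≈1 = ≈-trans (dot-g₃ b) (≈-trans (*-congˡ b′ₗ≈) (⁻¹-inverseˡ b′ₗ≉0))
      where
      b′ₗ≈ : b l + (- α) * b k ≈ b′ l
      b′ₗ≈ = solve 5 (λ bₗ aₗ bₖ aₖ i → bₗ ⊕ (⊝ (aₗ ⊗ i)) ⊗ bₖ ⊜ bₗ ⊕ (⊝ (bₖ ⊗ i)) ⊗ aₗ) ≈-refl (b l) (a l) (b k) (a k) (a k ⁻¹)

    a·g₂≈1 : dot a g₂ ≈ 1#
    a·g₂≈1 = ≈-trans (dot-g₂ a) (≈-trans (+-cong (⁻¹-inverseˡ aₖ≉0) (≈-trans (*-congˡ a·g₃≈0) (zeroʳ _))) (+-identityʳ 1#))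

    b·g₂≈0 : dot b g₂ ≈ 0#
    b·g₂≈0 = ≈-trans (dot-g₂ b) (≈-trans (+-congˡ (*-congˡ b·g₃≈1))
      (solve 2 (λ i bₖ → i ⊗ bₖ ⊕ (⊝ (bₖ ⊗ i)) ⊗ 1ᵉ ⊜ 0ᵉ) ≈-refl (a k ⁻¹) (b k)))

    dot-project : ∀ x w → dot x (project w) ≈ dot x w + (- dot a w) * dot x g₂ + (- dot b w) * dot x g₃
    dot-project x w = solve 18 (λ x₀ x₁ x₂ x₃ w₀ w₁ w₂ w₃ α p₀ p₁ p₂ p₃ β h₀ h₁ h₂ h₃ →
       x₀ ⊗ (w₀ ⊕ α ⊗ p₀ ⊕ β ⊗ h₀) ⊕ x₁ ⊗ (w₁ ⊕ α ⊗ p₁ ⊕ β ⊗ h₁) ⊕ x₂ ⊗ (w₂ ⊕ α ⊗ p₂ ⊕ β ⊗ h₂) ⊕ x₃ ⊗ (w₃ ⊕ α ⊗ p₃ ⊕ β ⊗ h₃)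
       ⊜ (x₀ ⊗ w₀ ⊕ x₁ ⊗ w₁ ⊕ x₂ ⊗ w₂ ⊕ x₃ ⊗ w₃) ⊕ α ⊗ (x₀ ⊗ p₀ ⊕ x₁ ⊗ p₁ ⊕ x₂ ⊗ p₂ ⊕ x₃ ⊗ p₃)
         ⊕ β ⊗ (x₀ ⊗ h₀ ⊕ x₁ ⊗ h₁ ⊕ x₂ ⊗ h₂ ⊕ x₃ ⊗ h₃))
       ≈-refl (x i₀) (x i₁) (x i₂) (x i₃) (w i₀) (w i₁) (w i₂) (w i₃) (- dot a w) (g₂ i₀) (g₂ i₁) (g₂ i₂) (g₂ i₃)
       (- dot b w) (g₃ i₀) (g₃ i₁) (g₃ i₂) (g₃ i₃)

    a·project≈0 : ∀ w → dot a (project w) ≈ 0#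
    a·project≈0 w = ≈-trans (dot-project a w) (≈-trans (+-cong (+-congˡ (*-congˡ a·g₂≈1)) (*-congˡ a·g₃≈0))
      (solve 2 (λ x y → x ⊕ (⊝ x) ⊗ 1ᵉ ⊕ (⊝ y) ⊗ 0ᵉ ⊜ 0ᵉ) ≈-refl (dot a w) (dot b w)))

    b·project≈0 : ∀ w → dot b (project w) ≈ 0#
    b·project≈0 w = ≈-trans (dot-project b w) (≈-trans (+-cong (+-congˡ (*-congˡ b·g₂≈0)) (*-congˡ b·g₃≈1))
      (solve 2 (λ x y → y ⊕ (⊝ x) ⊗ 0ᵉ ⊕ (⊝ y) ⊗ 1ᵉ ⊜ 0ᵉ) ≈-refl (dot a w) (dot b w)))

    g₃-vanishes : ∀ {t} → unit l t ≈ 0# → unit k t ≈ 0# → g₃ t ≈ 0#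
    g₃-vanishes uₗ≈0 uₖ≈0 = ≈-trans (*-congˡ (+-cong (*-congˡ uₗ≈0) (*-congˡ uₖ≈0)))
      (solve 2 (λ b a → b ⊗ (1ᵉ ⊗ 0ᵉ ⊕ a ⊗ 0ᵉ) ⊜ 0ᵉ) ≈-refl β (- α))

    g₂-vanishes : ∀ {t} → unit l t ≈ 0# → unit k t ≈ 0# → g₂ t ≈ 0#
    g₂-vanishes uₗ≈0 uₖ≈0 = ≈-trans (+-cong (*-congˡ uₖ≈0) (*-congˡ (g₃-vanishes uₗ≈0 uₖ≈0)))
      (solve 2 (λ i x → i ⊗ 0ᵉ ⊕ x ⊗ 0ᵉ ⊜ 0ᵉ) ≈-refl (a k ⁻¹) (- ρ))

    project-fixes : ∀ w {t} → unit l t ≈ 0# → unit k t ≈ 0# → project w t ≈ w t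
    project-fixes w uₗ≈0 uₖ≈0 = ≈-trans (+-cong (+-congˡ (*-congˡ (g₂-vanishes uₗ≈0 uₖ≈0))) (*-congˡ (g₃-vanishes uₗ≈0 uₖ≈0)))
      (solve 3 (λ w x y → w ⊕ x ⊗ 0ᵉ ⊕ y ⊗ 0ᵉ ⊜ w) ≈-refl _ _ _)

    form : Fin 4 → V
    form i₀ = unit m
    form i₁ = unit n
    form i₂ = a
    form i₃ = b

    basis : Fin 4 → V
    basis i₀ = project (unit m)
    basis i₁ = project (unit n)
    basis i₂ = g₂
    basis i₃ = g₃

    duality : ∀ i j → dot (form i) (basis j) ≈ unit i j
    duality i₀ i₀ = ≈-trans (dot-unitˡ (basis i₀) m) (≈-trans (project-fixes (unit m) unit-lm unit-km) unit-mm)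
    duality i₀ i₁ = ≈-trans (dot-unitˡ (basis i₁) m) (≈-trans (project-fixes (unit n) unit-lm unit-km) unit-nm)
    duality i₀ i₂ = ≈-trans (dot-unitˡ g₂ m) (g₂-vanishes unit-lm unit-km)
    duality i₀ i₃ = ≈-trans (dot-unitˡ g₃ m) (g₃-vanishes unit-lm unit-km)
    duality i₁ i₀ = ≈-trans (dot-unitˡ (basis i₀) n) (≈-trans (project-fixes (unit m) unit-ln unit-kn) unit-mn)
    duality i₁ i₁ = ≈-trans (dot-unitˡ (basis i₁) n) (≈-trans (project-fixes (unit n) unit-ln unit-kn) unit-nn)
    duality i₁ i₂ = ≈-trans (dot-unitˡ g₂ n) (g₂-vanishes unit-ln unit-kn)
    duality i₁ i₃ = ≈-trans (dot-unitˡ g₃ n) (g₃-vanishes unit-ln unit-kn)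
    duality i₂ i₀ = a·project≈0 (unit m)
    duality i₂ i₁ = a·project≈0 (unit n)
    duality i₂ i₂ = a·g₂≈1
    duality i₂ i₃ = a·g₃≈0
    duality i₃ i₀ = b·project≈0 (unit m)
    duality i₃ i₁ = b·project≈0 (unit n)
    duality i₃ i₂ = b·g₂≈0
    duality i₃ i₃ = b·g₃≈1

    unitₖ-expansion : ∀ t → unit k t ≈ a k * g₂ t + b k * g₃ t
    unitₖ-expansion t = ≈-sym (begin
      a k * (a k ⁻¹ * unit k t + (- ρ) * g₃ t) + b k * g₃ t
        ≈⟨ solve 5 (λ aₖ i eₖ bₖ g → aₖ ⊗ (i ⊗ eₖ ⊕ (⊝ (bₖ ⊗ i)) ⊗ g) ⊕ bₖ ⊗ g ⊜ eₖ ⊕ (aₖ ⊗ i ⊕ ⊝ 1ᵉ) ⊗ (eₖ ⊕ ⊝ (bₖ ⊗ g)))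
             ≈-refl (a k) (a k ⁻¹) (unit k t) (b k) (g₃ t) ⟩
      unit k t + (a k * a k ⁻¹ - 1#) * (unit k t - b k * g₃ t)   ≈⟨ +-congˡ (*-congʳ (+-congʳ (⁻¹-inverseʳ aₖ≉0))) ⟩
      unit k t + (1# - 1#) * (unit k t - b k * g₃ t)              ≈⟨ solve 2 (λ x y → x ⊕ (1ᵉ ⊕ ⊝ 1ᵉ) ⊗ y ⊜ x) ≈-refl (unit k t) _ ⟩
      unit k t                                                    ∎)

    unitₗ-expansion : ∀ t → unit l t ≈ a l * g₂ t + b l * g₃ t
    unitₗ-expansion t = ≈-sym (begin
      a l * (a k ⁻¹ * unit k t + (- ρ) * (β * (1# * unit l t + (- α) * unit k t))) + b l * (β * (1# * unit l t + (- α) * unit k t))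
        ≈⟨ solve 7 (λ aₗ i eₖ bₖ bₗ b⁻¹ eₗ →
             aₗ ⊗ (i ⊗ eₖ ⊕ (⊝ (bₖ ⊗ i)) ⊗ (b⁻¹ ⊗ (1ᵉ ⊗ eₗ ⊕ (⊝ (aₗ ⊗ i)) ⊗ eₖ))) ⊕ bₗ ⊗ (b⁻¹ ⊗ (1ᵉ ⊗ eₗ ⊕ (⊝ (aₗ ⊗ i)) ⊗ eₖ))
             ⊜ eₗ ⊕ (b⁻¹ ⊗ (bₗ ⊕ (⊝ (bₖ ⊗ i)) ⊗ aₗ) ⊕ ⊝ 1ᵉ) ⊗ (eₗ ⊕ ⊝ (aₗ ⊗ i ⊗ eₖ)))
             ≈-refl (a l) (a k ⁻¹) (unit k t) (b k) (b l) β (unit l t) ⟩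
      unit l t + (β * b′ l - 1#) * (unit l t - a l * a k ⁻¹ * unit k t)   ≈⟨ +-congˡ (*-congʳ (+-congʳ (⁻¹-inverseˡ b′ₗ≉0))) ⟩
      unit l t + (1# - 1#) * (unit l t - a l * a k ⁻¹ * unit k t)         ≈⟨ solve 2 (λ x y → x ⊕ (1ᵉ ⊕ ⊝ 1ᵉ) ⊗ y ⊜ x) ≈-refl (unit l t) _ ⟩
      unit l t                                                           ∎)

    -- Split w t = dot (unit t) w along k, l, m, n and expand unit k, unit l in g₂, g₃.
    expansion : ∀ w t → w t ≈ lincomb basis (λ j → dot (form j) w) t
    expansion w t = begin
      w t                                                                ≈⟨ dot-unitˡ w t ⟨
      dot (unit t) w                                                     ≈⟨ sum-reorder (λ i → unit t i * w i) ⟩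
      unit t k * w k + unit t l * w l + unit t m * w m + unit t n * w n
        ≈⟨ +-cong (+-cong (+-cong (*-congʳ (≈-trans (unit-sym t k) (unitₖ-expansion t))) (*-congʳ (≈-trans (unit-sym t l) (unitₗ-expansion t))))
                          (*-congʳ (unit-sym t m))) (*-congʳ (unit-sym t n)) ⟩
      (a k * g₂ t + b k * g₃ t) * w k + (a l * g₂ t + b l * g₃ t) * w l + unit m t * w m + unit n t * w n
        ≈⟨ solve 16 (λ wₖ wₗ wₘ wₙ aₖ aₗ aₘ aₙ bₖ bₗ bₘ bₙ G₂ G₃ Eₘ Eₙ →
             (aₖ ⊗ G₂ ⊕ bₖ ⊗ G₃) ⊗ wₖ ⊕ (aₗ ⊗ G₂ ⊕ bₗ ⊗ G₃) ⊗ wₗ ⊕ Eₘ ⊗ wₘ ⊕ Eₙ ⊗ wₙ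
             ⊜ wₘ ⊗ (Eₘ ⊕ (⊝ aₘ) ⊗ G₂ ⊕ (⊝ bₘ) ⊗ G₃) ⊕ (wₙ ⊗ (Eₙ ⊕ (⊝ aₙ) ⊗ G₂ ⊕ (⊝ bₙ) ⊗ G₃)
                ⊕ ((aₖ ⊗ wₖ ⊕ aₗ ⊗ wₗ ⊕ aₘ ⊗ wₘ ⊕ aₙ ⊗ wₙ) ⊗ G₂ ⊕ (bₖ ⊗ wₖ ⊕ bₗ ⊗ wₗ ⊕ bₘ ⊗ wₘ ⊕ bₙ ⊗ wₙ) ⊗ G₃)))
             ≈-refl (w k) (w l) (w m) (w n) (a k) (a l) (a m) (a n) (b k) (b l) (b m) (b n) (g₂ t) (g₃ t) (unit m t) (unit n t) ⟩
      w m * (unit m t + (- a m) * g₂ t + (- b m) * g₃ t) + (w n * (unit n t + (- a n) * g₂ t + (- b n) * g₃ t)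
         + ((a k * w k + a l * w l + a m * w m + a n * w n) * g₂ t + (b k * w k + b l * w l + b m * w m + b n * w n) * g₃ t))
        ≈⟨ +-cong (*-cong (dot-unitˡ w m) (+-cong (+-congˡ (*-congʳ (-‿cong (dot-unitʳ a m)))) (*-congʳ (-‿cong (dot-unitʳ b m)))))
             (+-cong (*-cong (dot-unitˡ w n) (+-cong (+-congˡ (*-congʳ (-‿cong (dot-unitʳ a n)))) (*-congʳ (-‿cong (dot-unitʳ b n)))))
               (+-cong (*-congʳ (sum-reorder (λ i → a i * w i))) (*-congʳ (sum-reorder (λ i → b i * w i))))) ⟨
      lincomb basis (λ j → dot (form j) w) t                             ∎

    dualBases : DualBases a b
    dualBases = record { form = form ; basis = basis ; form₂ = refl ; form₃ = refl ; duality = duality ; expansion = expansion }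

  module ChangeOfCoordinates {a b : V} (D : DualBases a b) where

    open DualBases D

    coords : V → V
    coords w j = dot (form j) w

    fromCoords : V → V
    fromCoords = lincomb basis

    formCoords : V → V
    formCoords K j = dot K (basis j)

    coords-fromCoords : ∀ c → coords (fromCoords c) ≋ c
    coords-fromCoords c j = ≈-trans (dot-lincombʳ (form j) basis c)
      (≈-trans (Σ₄-cong _ (λ i → c i * unit i j) λ i → *-congˡ (≈-trans (duality j i) (unit-sym j i))) (Σ₄-unit c j))

    formCoords-lincomb : ∀ c → formCoords (lincomb form c) ≋ c
    formCoords-lincomb c j = ≈-trans (dot-lincombˡ (basis j) form c) (≈-trans (Σ₄-cong _ (λ i → c i * unit i j) λ i → *-congˡ (duality i j)) (Σ₄-unit c j))

    dot-fromCoords : ∀ K c → dot K (fromCoords c) ≈ dot (formCoords K) c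
    dot-fromCoords K c = ≈-trans (dot-lincombʳ K basis c)
      (solve 8 (λ c₀ c₁ c₂ c₃ k₀ k₁ k₂ k₃ → c₀ ⊗ k₀ ⊕ (c₁ ⊗ k₁ ⊕ (c₂ ⊗ k₂ ⊕ c₃ ⊗ k₃)) ⊜ k₀ ⊗ c₀ ⊕ k₁ ⊗ c₁ ⊕ k₂ ⊗ c₂ ⊕ k₃ ⊗ c₃)
        ≈-refl (c i₀) (c i₁) (c i₂) (c i₃) (formCoords K i₀) (formCoords K i₁) (formCoords K i₂) (formCoords K i₃))

    dot-coords : ∀ K w → dot K w ≈ dot (formCoords K) (coords w)
    dot-coords K w = ≈-trans (dot-congʳ K (expansion w)) (dot-fromCoords K (coords w))

    form-expansion : ∀ K → K ≋ lincomb form (formCoords K)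
    form-expansion K t = begin
      K t                                    ≈⟨ dot-unitʳ K t ⟨
      dot K (unit t)                         ≈⟨ dot-coords K (unit t) ⟩
      dot (formCoords K) (coords (unit t))   ≈⟨ dot-congʳ (formCoords K) (λ j → dot-unitʳ (form j) t) ⟩
      dot (formCoords K) (λ j → form j t)
        ≈⟨ solve 8 (λ c₀ c₁ c₂ c₃ k₀ k₁ k₂ k₃ → k₀ ⊗ c₀ ⊕ k₁ ⊗ c₁ ⊕ k₂ ⊗ c₂ ⊕ k₃ ⊗ c₃ ⊜ k₀ ⊗ c₀ ⊕ (k₁ ⊗ c₁ ⊕ (k₂ ⊗ c₂ ⊕ k₃ ⊗ c₃)))
             ≈-refl (form i₀ t) (form i₁ t) (form i₂ t) (form i₃ t) (formCoords K i₀) (formCoords K i₁) (formCoords K i₂) (formCoords K i₃) ⟩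
      lincomb form (formCoords K) t          ∎

    coords-nonzero : ∀ {w} → NonZeroV w → NonZeroV (coords w)
    coords-nonzero {w} w≉0 c≈0 = w≉0 λ t → ≈-trans (expansion w t) (lincomb-zero basis c≈0 t)

    formCoords-nonzero : ∀ {K} → NonZeroV K → NonZeroV (formCoords K)
    formCoords-nonzero {K} K≉0 c≈0 = K≉0 λ t → ≈-trans (form-expansion K t) (lincomb-zero form c≈0 t)

    lincomb-form-nonzero : ∀ {c} → NonZeroV c → NonZeroV (lincomb form c)
    lincomb-form-nonzero {c} c≉0 K≈0 = c≉0 λ j → ≈-trans (≈-sym (formCoords-lincomb c j)) (dot-zeroˡ (basis j) K≈0)

    coords-SameSpan : ∀ {w w′} → SameSpan w w′ → SameSpan (coords w) (coords w′)
    coords-SameSpan {w} {w′} (c , c≉0 , w′≈cw) = c , c≉0 , λ j → ≈-trans (dot-congʳ (form j) w′≈cw) (dot-scaleʳ (form j) c w)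

    coords-SameSpan⁻ : ∀ {w w′} → SameSpan (coords w) (coords w′) → SameSpan w w′
    coords-SameSpan⁻ {w} {w′} (c , c≉0 , ψw′≈cψw) = c , c≉0 , λ t → begin
      w′ t                               ≈⟨ expansion w′ t ⟩
      lincomb basis (coords w′) t        ≈⟨ lincomb-cong basis ψw′≈cψw t ⟩
      lincomb basis (scale c (coords w)) t ≈⟨ lincomb-scale basis c (coords w) t ⟩
      c * lincomb basis (coords w) t     ≈⟨ *-congˡ (expansion w t) ⟨
      c * w t                            ∎

    formCoords-SameSpan : ∀ {K K′} → SameSpan K K′ → SameSpan (formCoords K) (formCoords K′)
    formCoords-SameSpan {K} {K′} (c , c≉0 , K′≈cK) = c , c≉0 , λ j → ≈-trans (dot-congˡ (basis j) K′≈cK) (dot-scaleˡ c K (basis j))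

    formCoords-SameSpan⁻ : ∀ {K K′} → SameSpan (formCoords K) (formCoords K′) → SameSpan K K′
    formCoords-SameSpan⁻ {K} {K′} (c , c≉0 , φK′≈cφK) = c , c≉0 , λ t → begin
      K′ t                                    ≈⟨ form-expansion K′ t ⟩
      lincomb form (formCoords K′) t          ≈⟨ lincomb-cong form φK′≈cφK t ⟩
      lincomb form (scale c (formCoords K)) t ≈⟨ lincomb-scale form c (formCoords K) t ⟩
      c * lincomb form (formCoords K) t       ≈⟨ *-congˡ (form-expansion K t) ⟨
      c * K t                                 ∎

    coords-lin : ∀ α u β w → coords (lin α u β w) ≋ lin α (coords u) β (coords w)
    coords-lin α u β w j = dot-lin (form j) α u β w

    fromCoords-independent : ∀ {c d} → Independent c d → Independent (fromCoords c) (fromCoords d)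
    fromCoords-independent {c} {d} c⊥d α β αc+βd≈0 = c⊥d α β λ j → begin
      α * c j + β * d j                                         ≈⟨ +-cong (*-congˡ (coords-fromCoords c j)) (*-congˡ (coords-fromCoords d j)) ⟨
      α * coords (fromCoords c) j + β * coords (fromCoords d) j ≈⟨ coords-lin α (fromCoords c) β (fromCoords d) j ⟨
      coords (lin α (fromCoords c) β (fromCoords d)) j          ≈⟨ dot-zeroʳ (form j) αc+βd≈0 ⟩
      0#                                                        ∎

    coords-InSpan : ∀ {c d p} → InSpan (fromCoords c) (fromCoords d) p → InSpan c d (coords p)
    coords-InSpan {c} {d} {p} (α , β , p≈αc+βd) = α , β , λ j → begin
      coords p j                                                ≈⟨ dot-congʳ (form j) p≈αc+βd ⟩
      coords (lin α (fromCoords c) β (fromCoords d)) j          ≈⟨ coords-lin α (fromCoords c) β (fromCoords d) j ⟩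
      α * coords (fromCoords c) j + β * coords (fromCoords d) j ≈⟨ +-cong (*-congˡ (coords-fromCoords c j)) (*-congˡ (coords-fromCoords d j)) ⟩
      α * c j + β * d j                                         ∎

    InSpan-basis⇒ : ∀ {p} → InSpan (basis i₀) (basis i₁) p → (coords p i₂ ≈ 0#) × (coords p i₃ ≈ 0#)
    InSpan-basis⇒ {p} (α , β , p≈αb₀+βb₁) = vanishes i₂ ≈-refl ≈-refl , vanishes i₃ ≈-refl ≈-refl
      where
      vanishes : ∀ j → unit j i₀ ≈ 0# → unit j i₁ ≈ 0# → coords p j ≈ 0#
      vanishes j u₀≈0 u₁≈0 = begin
        coords p j                                        ≈⟨ dot-congʳ (form j) p≈αb₀+βb₁ ⟩
        coords (lin α (basis i₀) β (basis i₁)) j          ≈⟨ coords-lin α (basis i₀) β (basis i₁) j ⟩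
        α * coords (basis i₀) j + β * coords (basis i₁) j ≈⟨ +-cong (*-congˡ (≈-trans (duality j i₀) u₀≈0)) (*-congˡ (≈-trans (duality j i₁) u₁≈0)) ⟩
        α * 0# + β * 0#                                   ≈⟨ solve 2 (λ a b → a ⊗ 0ᵉ ⊕ b ⊗ 0ᵉ ⊜ 0ᵉ) ≈-refl α β ⟩
        0#                                                ∎

    InSpan-basis⇐ : ∀ {p} → coords p i₂ ≈ 0# → coords p i₃ ≈ 0# → InSpan (basis i₀) (basis i₁) p
    InSpan-basis⇐ {p} p₂≈0 p₃≈0 = coords p i₀ , coords p i₁ , λ t → ≈-trans (expansion p t)
      (≈-trans (+-congˡ (+-congˡ (+-cong (*-congʳ p₂≈0) (*-congʳ p₃≈0))))
        (solve 6 (λ a u b v g h → a ⊗ u ⊕ (b ⊗ v ⊕ (0ᵉ ⊗ g ⊕ 0ᵉ ⊗ h)) ⊜ a ⊗ u ⊕ b ⊗ v)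
          ≈-refl (coords p i₀) (basis i₀ t) (coords p i₁) (basis i₁ t) (basis i₂ t) (basis i₃ t)))

module CoverThroughCoordinatePlanes (r : ℕ) (R : CommutativeRing 0ℓ 0ℓ) (FF : IsFiniteField (suc (suc r)) R) where

  open import Data.Nat as ℕ using (zero; suc; _≤_)
  import Data.Nat.Properties as ℕ
  open import Data.Nat.Solver using (module +-*-Solver)
  open import Data.Fin as Fin using (Fin; zero; suc; _↑ʳ_; combine)
  import Data.Fin.Properties as Fin
  open import Data.Product using (∃; _×_; _,_; proj₁; proj₂)
  open import Data.Sum using (_⊎_; inj₁; inj₂)
  open import Data.Empty using (⊥; ⊥-elim)
  open import Relation.Nullary using (¬_; yes; no)
  open import Relation.Nullary.Decidable using (decidable-stable)
  open import Relation.Binary.PropositionalEquality as ≡ using (_≢_; refl; subst)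
  open import Data.Vec.Functional using (Vector; _++_; concat)
  open import Data.Vec.Functional.Properties using (lookup-++ˡ; lookup-++ʳ)
  open import Data.Vec.Functional.Relation.Unary.All using (All)
  open CommutativeRing R renaming (Carrier to F; refl to ≈-refl; sym to ≈-sym; trans to ≈-trans) hiding (zero)
  open PG R
  open IsFiniteField FF
  open import Relation.Binary.Reasoning.Setoid setoid
  open IntegerCoefficientRingSolver R using (solve; _⊜_; _⊕_; _⊗_; ⊝_; 0ᵉ; 1ᵉ)
  open Combinatorics
  open FiniteProjectiveSpace (suc (suc r)) R FF

  q : ℕ
  q = suc (suc r)

  #points≰1+q³ : ¬ (#points ≤ suc (q ℕ.* q ℕ.* q))
  #points≰1+q³ le = ℕ.m+1+n≰m (suc (q ℕ.* q ℕ.* q)) (subst (_≤ suc (q ℕ.* q ℕ.* q)) split le)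
    where
    open +-*-Solver using (con; _:+_; _:*_; _:=_) renaming (solve to solveℕ)
    split : #points ≡ suc (q ℕ.* q ℕ.* q) ℕ.+ suc (q ℕ.* q ℕ.+ suc r)
    split = solveℕ 1 (λ r → let q = con 2 :+ r in
      q :* (q :* q) :+ (q :* q :+ (q :+ con 1)) := con 1 :+ q :* q :* q :+ (con 1 :+ (q :* q :+ (con 1 :+ r)))) refl r

  record NormalisedCover : Set where
    field
      #pts              : ℕ
      #pts≡q²           : #pts ≡ q ℕ.* q
      point             : Vector V #pts
      point-nonzero     : All NonZeroV point
      point-irredundant : Irredundant point
      plane             : Vector V q
      plane-nonzero     : All NonZeroV plane
      plane-irredundant : Irredundant plane
      plane₀≋e₂         : plane zero ≋ e₂
      plane₁≋e₃         : plane (suc zero) ≋ e₃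
      covers-lines      : ∀ c d → Independent c d →
                          (∃ λ i → InSpan c d (point i)) ⊎ (∃ λ j → dot (plane j) c ≈ 0# × dot (plane j) d ≈ 0#)

  module _ (C : NormalisedCover) where

    open NormalisedCover C

    -- The lines through a point z on no plane of the cover and off its points each need
    -- their own point of the cover, so they list all points with only 1 + q² · q entries.
    module _ (z : V) (z≉0 : NonZeroV z) (z∉points : ∀ i → ¬ SameSpan (point i) z) (z∉planes : ∀ j → dot (plane j) z ≉0) where

      joinZ : Fin #pts → Fin q → V
      joinZ i a k = point i k + enum a * z k

      throughZ : Vector V (1 ℕ.+ #pts ℕ.* q)
      throughZ = (λ _ → z) ++ concat joinZ

      throughZ-exhaustive : Exhausts throughZ points
      throughZ-exhaustive m with SameSpan? z (points m)
      ... | yes z~m = lists-++ˡ (λ _ → z) _ (zero , z~m)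
      ... | no z≁m with covers-lines z (points m) (independent z≉0 (points-nonzero m) z≁m)
      ...   | inj₂ (j , zj≈0 , _) = ⊥-elim (z∉planes j zj≈0)
      ...   | inj₁ (i , α , β , pi≈αz+βm) with β ≟F 0#
      ...     | yes β≈0 = ⊥-elim (z∉points i (SameSpan-sym (SameSpan-multiple α (point-nonzero i) pi≈αz)))
        where
        pi≈αz : ∀ k → point i k ≈ α * z k
        pi≈αz k = ≈-trans (pi≈αz+βm k) (≈-trans (+-congˡ (≈-trans (*-congʳ β≈0) (zeroˡ _))) (+-identityʳ _))
      ...     | no β≉0 =
        let (a , ea≈-α) = enum-surj (- α) in
        lists-++ʳ (λ _ → z) (concat joinZ) (lists-concat joinZ (i , a , β ⁻¹ , ⁻¹-nonzero β≉0 , λ k → ≈-sym (begin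
          β ⁻¹ * (point i k + enum a * z k)              ≈⟨ *-congˡ (+-cong (pi≈αz+βm k) (*-congʳ ea≈-α)) ⟩
          β ⁻¹ * ((α * z k + β * points m k) + - α * z k) ≈⟨ solve 5 (λ α β m zₖ β⁻¹ → β⁻¹ ⊗ ((α ⊗ zₖ ⊕ β ⊗ m) ⊕ ⊝ α ⊗ zₖ) ⊜ (β⁻¹ ⊗ β) ⊗ m)
                                                               ≈-refl α β (points m k) (z k) (β ⁻¹) ⟩
          (β ⁻¹ * β) * points m k                       ≈⟨ ≈-trans (*-congʳ (⁻¹-inverseˡ β≉0)) (*-identityˡ _) ⟩
          points m k                                    ∎)))

      absurd : ⊥
      absurd = #points≰1+q³
        (subst (λ n → #points ≤ suc (n ℕ.* q)) #pts≡q² (exhausts⇒≤ points-irredundant throughZ-exhaustive))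

    off-points⇒on-plane : ∀ w → NonZeroV w → ¬ Lists point w → ∃ λ j → dot (plane j) w ≈ 0#
    off-points⇒on-plane w w≉0 w∉points with Fin.any? (λ j → dot (plane j) w ≟F 0#)
    ... | yes on-plane = on-plane
    ... | no ∄plane = ⊥-elim (absurd w w≉0 (λ i s → w∉points (i , s)) (λ j d → ∄plane (j , d)))

    plane≁e₂ : ∀ j → ¬ SameSpan e₂ (plane (suc j))
    plane≁e₂ j e₂~plane with plane-irredundant zero (suc j) (SameSpan-congˡ (λ i → ≈-sym (plane₀≋e₂ i)) e₂~plane)
    ... | ()

    pivot : ∀ j → Pivot₀₁₃ (plane (suc j))
    pivot j = pivot₀₁₃ (plane (suc j)) (plane-nonzero (suc j)) (plane≁e₂ j)

    affinePart : Fin (suc r) → Fin q → Fin q → V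
    affinePart j = affinePoints (plane (suc j)) (pivot j)

    #planePoints : ℕ
    #planePoints = q ℕ.* q ℕ.+ (q ℕ.+ 1) ℕ.+ suc r ℕ.* (q ℕ.* q)

    -- Each point on a plane of the cover, listed via the first plane (x₂ = 0) when it lies
    -- there, and via every other plane through it otherwise.
    planePoints : Vector V #planePoints
    planePoints = pointsOfΠ₂ ++ concat λ j → concat (affinePart j)

    planePoints-exhaustive : ∀ w → NonZeroV w → ∀ j → dot (plane j) w ≈ 0# → Lists planePoints w
    planePoints-exhaustive w w≉0 j on-j with w i₂ ≟F 0#
    ... | yes w₂≈0 = lists-++ˡ pointsOfΠ₂ _ (pointsOfΠ₂-exhaustive w w≉0 w₂≈0)
    ... | no w₂≉0 = via j on-j
      where
      via : ∀ j → dot (plane j) w ≈ 0# → Lists planePoints w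
      via zero    on-0 = ⊥-elim (w₂≉0 (≈-trans (≈-sym (dot-e₂ w)) (≈-trans (dot-congˡ w (λ i → ≈-sym (plane₀≋e₂ i))) on-0)))
      via (suc j) on-j = lists-++ʳ pointsOfΠ₂ _ (lists-concat (λ j → concat (affinePart j))
        (j , lists-concat (affinePart j) (affinePoints-exhaustive (plane (suc j)) w on-j w₂≉0 (pivot j))))

    coveredPoints : Vector V (#pts ℕ.+ #planePoints)
    coveredPoints = point ++ planePoints

    coveredPoints-exhaustive : Exhausts coveredPoints points
    coveredPoints-exhaustive m with Lists? point (points m)
    ... | yes listed = lists-++ˡ point planePoints listed
    ... | no unlisted =
      let (j , on-j) = off-points⇒on-plane (points m) (points-nonzero m) unlisted in
      lists-++ʳ point planePoints (planePoints-exhaustive (points m) (points-nonzero m) j on-j)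

    #coveredPoints≡ : #pts ℕ.+ #planePoints ≡ #points
    #coveredPoints≡ = ≡.trans (≡.cong (ℕ._+ #planePoints) #pts≡q²)
      (solveℕ 1 (λ r → let q = con 2 :+ r in
         q :* q :+ (q :* q :+ (q :+ con 1) :+ (con 1 :+ r) :* (q :* q)) := q :* (q :* q) :+ (q :* q :+ (q :+ con 1))) refl r)
      where open +-*-Solver using (con; _:+_; _:*_; _:=_) renaming (solve to solveℕ)

    listed-once : ∀ {k l} w → NonZeroV w → SameSpan (coveredPoints k) w → SameSpan (coveredPoints l) w → k ≡ l
    listed-once w w≉0 k~w l~w =
      let (i , pi~w) = points-exhaustive w w≉0 in
      exhausts-exactly points-irredundant coveredPoints-exhaustive (ℕ.≤-reflexive #coveredPoints≡) i
        (SameSpan-trans k~w (SameSpan-sym pi~w)) (SameSpan-trans l~w (SameSpan-sym pi~w))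

    point-off-planes : ∀ i j → dot (plane j) (point i) ≉0
    point-off-planes i j on-j =
      let (k , k~pi) = planePoints-exhaustive (point i) (point-nonzero i) j on-j in
      ↑ˡ≢↑ʳ i k (listed-once (point i) (point-nonzero i)
        (SameSpan-≡ˡ (lookup-++ˡ point planePoints i) (SameSpan-refl (point i)))
        (SameSpan-≡ˡ (lookup-++ʳ point planePoints k) k~pi))

    affineIndex : Fin (suc r) → Fin q → Fin q → Fin (#pts ℕ.+ #planePoints)
    affineIndex j s t = #pts ↑ʳ (q ℕ.* q ℕ.+ (q ℕ.+ 1) ↑ʳ combine j (combine s t))

    lookup-affineIndex : ∀ j s t → coveredPoints (affineIndex j s t) ≡ affinePart j s t
    lookup-affineIndex j s t = ≡.trans (lookup-++ʳ point planePoints _) (≡.trans (lookup-++ʳ pointsOfΠ₂ (concat λ j → concat (affinePart j)) _)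
      (≡.trans (lookup-concat (λ j → concat (affinePart j)) j (combine s t)) (lookup-concat (affinePart j) s t)))

    planes-meet-on-Π₂ : ∀ j j′ → j ≢ j′ → ∀ w → w i₂ ≉0 → dot (plane (suc j)) w ≈ 0# → dot (plane (suc j′)) w ≈ 0# → ⊥
    planes-meet-on-Π₂ j j′ j≢j′ w w₂≉0 on-j on-j′ =
      let (s , t , st~w) = affinePoints-exhaustive (plane (suc j)) w on-j w₂≉0 (pivot j)
          (s′ , t′ , st~w′) = affinePoints-exhaustive (plane (suc j′)) w on-j′ w₂≉0 (pivot j′) in
      j≢j′ (Fin.combine-injectiveˡ j (combine s t) j′ (combine s′ t′) (Fin.↑ʳ-injective (q ℕ.* q ℕ.+ (q ℕ.+ 1)) _ _ (Fin.↑ʳ-injective #pts _ _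
        (listed-once w (nonzero-at i₂ w₂≉0) (SameSpan-≡ˡ (lookup-affineIndex j s t) st~w)
                                            (SameSpan-≡ˡ (lookup-affineIndex j′ s′ t′) st~w′)))))

    -- Such a plane would share with plane₁ (x₃ = 0) a point off plane₀ (x₂ = 0).
    no-plane-crosses-axis : ∀ j → plane (suc (suc j)) i₀ ≉0 ⊎ plane (suc (suc j)) i₁ ≉0 → ⊥
    no-plane-crosses-axis j p =
      let (w , w₂≈1 , w₃≈0 , on-K) = meets-Π₃-off-Π₂ (plane (suc (suc j))) p in
      planes-meet-on-Π₂ zero (suc j) (λ ()) w (λ w₂≈0 → 1≉0 (≈-trans (≈-sym w₂≈1) w₂≈0))
        (≈-trans (dot-congˡ w plane₁≋e₃) (≈-trans (dot-e₃ w) w₃≈0)) on-K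

    plane-containsAxis : ∀ j → ContainsAxis (plane j)
    plane-containsAxis zero          = plane₀≋e₂ i₀ , plane₀≋e₂ i₁
    plane-containsAxis (suc zero)    = plane₁≋e₃ i₀ , plane₁≋e₃ i₁
    plane-containsAxis (suc (suc j)) with plane (suc (suc j)) i₀ ≟F 0# | plane (suc (suc j)) i₁ ≟F 0#
    ... | yes K₀≈0 | yes K₁≈0 = K₀≈0 , K₁≈0
    ... | no K₀≉0  | _        = ⊥-elim (no-plane-crosses-axis j (inj₁ K₀≉0))
    ... | yes _    | no K₁≉0  = ⊥-elim (no-plane-crosses-axis j (inj₂ K₁≉0))

    plane-in-pencil : Exhausts pencil plane
    plane-in-pencil j = pencil-exhaustive (plane j) (plane-nonzero j) (plane-containsAxis j)

    missing-plane : ∃ λ s₀ → ¬ Lists plane (pencil s₀)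
    missing-plane with Fin.all? (λ s → Lists? plane (pencil s))
    ... | yes all-listed = ⊥-elim (ℕ.m+1+n≰m q (exhausts⇒≤ pencil-irredundant all-listed))
    ... | no ¬all-listed = Fin.¬∀⟶∃¬ _ _ (λ s → Lists? plane (pencil s)) ¬all-listed

    -- s₀ is a module parameter, not a definition: unfolding it during type checking would
    -- run the decision procedure that found it.
    module MissingPlane (s₀ : Fin (q ℕ.+ 1)) (s₀-unlisted : ¬ Lists plane (pencil s₀)) where

      H : V
      H = pencil s₀

      H-unlisted : ∀ j → ¬ SameSpan (plane j) H
      H-unlisted j j~H = s₀-unlisted (j , j~H)

      unlisted-unchosen : ∀ {s} → ¬ Lists plane (pencil s) → ∀ j → choice plane-in-pencil j ≢ s
      unlisted-unchosen unlisted j refl = unlisted (j , SameSpan-sym (proj₂ (plane-in-pencil j)))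

      -- q planes of a pencil of q + 1 planes miss at most one of them.
      pencil-listed : ∀ s → s ≢ s₀ → Lists plane (pencil s)
      pencil-listed s s≢s₀ = decidable-stable (Lists? plane (pencil s)) λ unlisted →
        2+n≰n+1 q (injective-missing-two⇒ (choice-injective plane-irredundant plane-in-pencil) s₀ s (λ e → s≢s₀ (≡.sym e))
          (unlisted-unchosen s₀-unlisted) (unlisted-unchosen unlisted))

      H-nonzero : NonZeroV H
      H-nonzero = pencil-nonzero s₀

      H-containsAxis : ContainsAxis H
      H-containsAxis = pencil-containsAxis s₀

      points⇒ : ∀ w → Lists point w → dot H w ≈ 0# × OffAxis w
      points⇒ w (i , i~w) = on-H , w-off
        where
        off-planes : ∀ j → dot (plane j) w ≉0
        off-planes j = dot-≉0-respʳ (plane j) i~w (point-off-planes i j)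
        w-off : OffAxis w
        w-off (w₂≈0 , _) = off-planes zero (≈-trans (dot-congˡ w plane₀≋e₂) (≈-trans (dot-e₂ w) w₂≈0))
        on-H : dot H w ≈ 0#
        on-H = decidable-stable (dot H w ≟F 0#) λ off-H →
          let (s , on-s) = pencil-through w w-off
              (j , j~s) = pencil-listed s (λ s≡s₀ → off-H (subst (λ s → dot (pencil s) w ≈ 0#) s≡s₀ on-s)) in
          off-planes j (dot-≈0-respˡ w (SameSpan-sym j~s) on-s)

      points⇐ : ∀ w → NonZeroV w → dot H w ≈ 0# → OffAxis w → Lists point w
      points⇐ w w≉0 on-H w-off = decidable-stable (Lists? point w) λ unlisted →
        let (j , on-j) = off-points⇒on-plane w w≉0 unlisted in
        H-unlisted j (SameSpan-trans
          (SameSpan-sym (axisForm-unique (plane j) w (plane-nonzero j) (plane-containsAxis j) w-off on-j))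
          (axisForm-unique H w H-nonzero H-containsAxis w-off on-H))

      planes⇒ : ∀ K → Lists plane K → ¬ SameSpan H K × ContainsAxis K
      planes⇒ K (j , j~K) =
        (λ H~K → H-unlisted j (SameSpan-trans j~K (SameSpan-sym H~K))) ,
        coordinate-≈0-resp i₀ j~K (proj₁ (plane-containsAxis j)) , coordinate-≈0-resp i₁ j~K (proj₂ (plane-containsAxis j))

      planes⇐ : ∀ K → NonZeroV K → ¬ SameSpan H K → ContainsAxis K → Lists plane K
      planes⇐ K K≉0 H≁K K⊇axis =
        let (s , s~K) = pencil-exhaustive K K≉0 K⊇axis
            (j , j~s) = pencil-listed s (λ s≡s₀ → H≁K (subst (λ s → SameSpan (pencil s) K) s≡s₀ s~K)) in
        j , SameSpan-trans j~s s~K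


module Transfer (R : CommutativeRing 0ℓ 0ℓ) {π₁ π₂ : PG.Plane R} {rest : List (PG.Plane R)}
  (FF : IsFiniteField (length (π₁ ∷ π₂ ∷ rest)) R) where

  open import Data.Nat as ℕ using (s≤s; z≤n)
  open import Data.Fin using (Fin; zero)
  open import Data.Product using (∃; Σ-syntax; _×_; _,_; proj₁; proj₂)
  open import Data.Sum as Sum using (_⊎_)
  open import Data.Empty using (⊥-elim)
  open import Relation.Nullary using (¬_)
  open import Relation.Binary.PropositionalEquality using (refl; subst)
  open import Data.List using (_∷_; lookup)
  open import Data.List.Relation.Unary.Any as Any using (Any)
  open import Data.List.Relation.Unary.Any.Properties using (lookup-index)
  open import Data.List.Membership.Propositional using (lose)
  open import Data.List.Membership.Propositional.Properties using (∈-lookup)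
  open import Function.Bundles using (_⇔_; mk⇔; Equivalence)
  open CommutativeRing R renaming (refl to ≈-refl; sym to ≈-sym; trans to ≈-trans) hiding (zero)
  open PG R
  open Combinatorics using (AllPairs-lookup-injective)
  open FiniteProjectiveSpace (length (π₁ ∷ π₂ ∷ rest)) R FF
  open CoverThroughCoordinatePlanes (length rest) R FF

  hs : List Plane
  hs = π₁ ∷ π₂ ∷ rest

  module Normalise (D : DualBases (proj₁ π₁) (proj₁ π₂))
    (ps : List Point) (cover : IsCover ps hs) (|ps|≡q² : length ps ≡ q ℕ.* q) where

    open DualBases D
    open ChangeOfCoordinates D

    covers-lines : ∀ c d → Independent c d →
      (∃ λ i → InSpan c d (coords (proj₁ (lookup ps i)))) ⊎
      (∃ λ j → dot (formCoords (proj₁ (lookup hs j))) c ≈ 0# × dot (formCoords (proj₁ (lookup hs j))) d ≈ 0#)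
    covers-lines c d c⊥d = Sum.map
      (λ on-point → Any.index on-point , coords-InSpan (lookup-index on-point))
      (λ in-plane → let K = proj₁ (lookup hs (Any.index in-plane)) in Any.index in-plane ,
         ≈-trans (≈-sym (dot-fromCoords K c)) (proj₁ (lookup-index in-plane)) ,
         ≈-trans (≈-sym (dot-fromCoords K d)) (proj₂ (lookup-index in-plane)))
      (proj₂ (proj₂ cover) (line (fromCoords c) (fromCoords d) (fromCoords-independent c⊥d)))

    normalisedCover : NormalisedCover
    normalisedCover = record
      { #pts              = length ps
      ; #pts≡q²           = |ps|≡q²
      ; point             = λ i → coords (proj₁ (lookup ps i))
      ; point-nonzero     = λ i → coords-nonzero (proj₂ (lookup ps i))
      ; point-irredundant = λ i j s → AllPairs-lookup-injective SameSpan-sym (proj₁ cover) i j (coords-SameSpan⁻ s)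
      ; plane             = λ j → formCoords (proj₁ (lookup hs j))
      ; plane-nonzero     = λ j → formCoords-nonzero (proj₂ (lookup hs j))
      ; plane-irredundant = λ i j s → AllPairs-lookup-injective SameSpan-sym (proj₁ (proj₂ cover)) i j (formCoords-SameSpan⁻ s)
      ; plane₀≋e₂         = λ j → subst (λ x → dot x (basis j) ≈ unit i₂ j) form₂ (duality i₂ j)
      ; plane₁≋e₃         = λ j → subst (λ x → dot x (basis j) ≈ unit i₃ j) form₃ (duality i₃ j)
      ; covers-lines      = covers-lines
      }

    open NormalisedCover normalisedCover using (point; plane)

    module Standard (missing : ∃ λ s₀ → ¬ Lists plane (pencil s₀)) where

      open MissingPlane normalisedCover (proj₁ missing) (proj₂ missing)

      Hᵖ : Plane
      Hᵖ = lincomb form H , lincomb-form-nonzero H-nonzero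

      x : Point
      x = basis i₀ , λ b₀≈0 → 1≉0 (≈-trans (≈-sym (duality i₀ i₀)) (dot-zeroʳ (form i₀) b₀≈0))

      y : Fin 1 → Point
      y _ = basis i₁ , λ b₁≈0 → 1≉0 (≈-trans (≈-sym (duality i₁ i₁)) (dot-zeroʳ (form i₁) b₁≈0))

      on-Hᵖ⇔ : ∀ (p : Point) → OnPlane p Hᵖ ⇔ dot H (coords (proj₁ p)) ≈ 0#
      on-Hᵖ⇔ p = mk⇔ (≈-trans (≈-sym H-coords)) (≈-trans H-coords)
        where
        H-coords : dot (lincomb form H) (proj₁ p) ≈ dot H (coords (proj₁ p))
        H-coords = ≈-trans (dot-coords (lincomb form H) (proj₁ p)) (dot-congˡ (coords (proj₁ p)) (formCoords-lincomb H))

      SameHᵖ⇔ : ∀ (K : Plane) → SamePlane Hᵖ K ⇔ SameSpan H (formCoords (proj₁ K))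
      SameHᵖ⇔ K = mk⇔ (λ s → SameSpan-congˡ (formCoords-lincomb H) (formCoords-SameSpan s))
                      (λ s → formCoords-SameSpan⁻ (SameSpan-congˡ (λ j → ≈-sym (formCoords-lincomb H j)) s))

      H-at-basis : ∀ k → dot H (coords (basis k)) ≈ H k
      H-at-basis k = ≈-trans (dot-congʳ H (λ j → ≈-trans (duality j k) (unit-sym j k))) (dot-unitʳ H k)

      point-listed⇔ : ∀ (p : Point) → Any (SamePoint p) ps ⇔ Lists point (coords (proj₁ p))
      point-listed⇔ p = mk⇔
        (λ listed → Any.index listed , coords-SameSpan (SameSpan-sym (lookup-index listed)))
        (λ (i , i~p) → lose (∈-lookup i) (SameSpan-sym (coords-SameSpan⁻ {proj₁ (lookup ps i)} {proj₁ p} i~p)))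

      plane-listed⇔ : ∀ (K : Plane) → Any (SamePlane K) hs ⇔ Lists plane (formCoords (proj₁ K))
      plane-listed⇔ K = mk⇔
        (λ listed → Any.index listed , formCoords-SameSpan (SameSpan-sym (lookup-index listed)))
        (λ (j , j~K) → lose (∈-lookup j) (SameSpan-sym (formCoords-SameSpan⁻ {proj₁ (lookup hs j)} {proj₁ K} j~K)))

      points⇔ : (p : Point) → Any (SamePoint p) ps ⇔ (OnPlane p Hᵖ × ((i : Fin 1) → ¬ InSpan (basis i₀) (basis i₁) (proj₁ p)))
      points⇔ p = mk⇔
        (λ listed → let (on-H , off-axis) = points⇒ (coords (proj₁ p)) (Equivalence.to (point-listed⇔ p) listed) in
           Equivalence.from (on-Hᵖ⇔ p) on-H , λ _ on-axis → off-axis (InSpan-basis⇒ on-axis))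
        (λ (on-Hᵖ , off-axis) → Equivalence.from (point-listed⇔ p)
           (points⇐ (coords (proj₁ p)) (coords-nonzero (proj₂ p)) (Equivalence.to (on-Hᵖ⇔ p) on-Hᵖ)
             (λ (p₂≈0 , p₃≈0) → off-axis zero (InSpan-basis⇐ p₂≈0 p₃≈0))))

      planes⇔ : (K : Plane) → Any (SamePlane K) hs ⇔ (¬ SamePlane Hᵖ K × Σ[ i ∈ Fin 1 ] (OnPlane x K × OnPlane (y i) K))
      planes⇔ K = mk⇔
        (λ listed → let (H≁K , K₀≈0 , K₁≈0) = planes⇒ (formCoords (proj₁ K)) (Equivalence.to (plane-listed⇔ K) listed) in
           (λ s → H≁K (Equivalence.to (SameHᵖ⇔ K) s)) , zero , K₀≈0 , K₁≈0)
        (λ (Hᵖ≁K , _ , K₀≈0 , K₁≈0) → Equivalence.from (plane-listed⇔ K)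
           (planes⇐ (formCoords (proj₁ K)) (formCoords-nonzero (proj₂ K)) (λ s → Hᵖ≁K (Equivalence.from (SameHᵖ⇔ K) s)) (K₀≈0 , K₁≈0)))

      isStandardCover : IsStandardCover q ps hs
      isStandardCover =
        Hᵖ , x , Equivalence.from (on-Hᵖ⇔ x) (≈-trans (H-at-basis i₀) (proj₁ H-containsAxis)) ,
        1 , s≤s z≤n , s≤s z≤n , y ,
        (λ _ → Equivalence.from (on-Hᵖ⇔ (y zero)) (≈-trans (H-at-basis i₁) (proj₂ H-containsAxis))) ,
        (λ _ x~y → SameSpan-one-zero i₀ (duality i₀ i₀) (duality i₀ i₁) (coords-SameSpan x~y)) ,
        (λ { zero zero 0≢0 → ⊥-elim (0≢0 refl) }) ,
        points⇔ , planes⇔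

mainTheorem11 : (q : ℕ) (R : CommutativeRing 0ℓ 0ℓ) → IsFiniteField q R →
    (ps : List (PG.Point R)) (hs : List (PG.Plane R)) →
    PG.IsCover R ps hs → length ps ≡ q ^ 2 → length hs ≡ q →
    PG.IsStandardCover R q ps hs
mainTheorem11 q R FF ps []       _ _ |hs|≡q with () ← ≡.trans |hs|≡q (proj₂ (FiniteProjectiveSpace.q≡2+ q R FF))
mainTheorem11 q R FF ps (_ ∷ []) _ _ |hs|≡q with () ← ≡.trans |hs|≡q (proj₂ (FiniteProjectiveSpace.q≡2+ q R FF))
mainTheorem11 _ R FF ps (π₁ ∷ π₂ ∷ rest) cover@(_ , (π₁≁π₂ ∷ _) ∷ _ , _) |ps|≡q² ≡.refl =
  Standard.isStandardCover (missing-plane normalisedCover)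
  where
  open FiniteProjectiveSpace (length (π₁ ∷ π₂ ∷ rest)) R FF
  open CoverThroughCoordinatePlanes (length rest) R FF using (missing-plane)
  open Transfer R {π₁} {π₂} {rest} FF
  adapted : DualBases (proj₁ π₁) (proj₁ π₂)
  adapted = DualBasesExtending.dualBases (proj₁ π₁) (proj₁ π₂) (proj₂ π₁) (proj₂ π₂) π₁≁π₂
  open Normalise adapted ps cover (≡.trans |ps|≡q² (≡.cong (length hs ℕ.*_) (ℕ.*-identityʳ (length hs))))
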